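{- Let $m, s_1, \dots, s_m \in \mathbb{N}_0$, $s_{m+1} \in \mathbb{N}$. Then for any positive integer $n$, $$H_n^*[\{2\}^{s_1}, 1, \dots, \{2\}^{s_m}, 1, \{2\}^{s_{m+1}}] = - \sum_{\mathbf{p}=(2s_1+1)\circ\dots\circ(2s_m+1)\circ(2s_{m+1})} \overline{\mathcal{H}}_n[\mathbf{p}; \widetilde{\mathbf{p}}],$$ where $\circ$ is either comma or plus, and the string $\widetilde{\mathbf{p}} := (s_1+1) \circ \dots \circ (s_m+1) \circ (s_{m+1})$ is associated with the string $\mathbf{p}$, i.e. the choice of commas and pluses in $\mathbf{p}$ and $\widetilde{\mathbf{p}}$ is the same.
   Context: Let $0<q<1$, $[n]_q = \frac{1-q^n}{1-q}$, $(q)_n=\prod_{k=0}^{n-1}(1-q^{k+1})$, and $\begin{bmatrix} n \\ m \end{bmatrix} = \frac{(q)_n}{(q)_m (q)_{n-m}}$ for $0\le m\le n$, $0$ otherwise. $H_n^*[s_1,\dots,s_m] = \sum_{n \geq k_1 \geq \dots \geq k_m \geq 1} \prod_{j=1}^m \frac{q^{k_j}}{[k_j]_q^{s_j}}$ with $H_n^*[\emptyset]=1$. For $m\ge0$, $\mathbf{s},\mathbf{t}\in\mathbb{Z}^m$, $\overline{\mathcal{H}}_n[\mathbf{s}; \mathbf{t}] = \sum_{n \geq k_1 > \dots > k_m \geq 1} (-1)^{k_m} \frac{\begin{bmatrix} n \\ k_1 \end{bmatrix}}{\begin{bmatrix} n+k_1 \\ k_1 \end{bmatrix}} q^{k_1^2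 - k_m(k_m-1)/2} \prod_{j=1}^m \frac{(1+q^{k_j})q^{(t_j-1)k_j}}{[k_j]_q^{s_j}}$, with $\overline{\mathcal{H}}_n=0$ if $n<m$ and $=1$ if $m=0$. $\{2\}^a$ denotes $a$ consecutive 2's.
   Formalization: The parameter q ranges over the rationals with $0<q<1$ instead of the reals. -}

module Defs where

open import Data.Nat as ℕ using (ℕ; zero; suc)
open import Data.Integer as ℤ using (ℤ; +_; -[1+_])
open import Data.Rational using (ℚ; 0ℚ; 1ℚ; _+_; _*_; -_; _-_; 1/_; ≢-nonZero)
open import Data.Rational.Properties using (_≟_)
open import Data.List using (List; []; _∷_; _++_; map; foldr; concatMap; concat; replicate; length)
open import Data.Vec as Vec using (Vec; []; _∷_)
open import Data.Product using (Σ; _×_; _,_; proj₁; proj₂)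
open import Relation.Nullary using (yes; no)

sumℚ : List ℚ → ℚ
sumℚ = foldr _+_ 0ℚ

prodℚ : List ℚ → ℚ
prodℚ = foldr _*_ 1ℚ

range1 : ℕ → List ℕ
range1 zero = []
range1 (suc b) = range1 b ++ (suc b ∷ [])

-- total inverse (x⁻¹, with the junk value 0⁻¹ = 0; only ever applied to
-- nonzero quantities when 0 < q < 1)
inv : ℚ → ℚ
inv x with x ≟ 0ℚ
... | yes _ = 0ℚ
... | no x≢0 = 1/_ x {{≢-nonZero x≢0}}

_^_ : ℚ → ℕ → ℚ
x ^ zero = 1ℚ
x ^ suc n = x * (x ^ n)

_^ℤ_ : ℚ → ℤ → ℚ
x ^ℤ (+ n) = x ^ n
x ^ℤ -[1+ n ] = inv (x ^ suc n)

module _ (q : ℚ) where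

  qint : ℕ → ℚ
  qint n = (1ℚ - q ^ n) * inv (1ℚ - q)

  qpoch : ℕ → ℚ
  qpoch n = prodℚ (map (λ k → 1ℚ - q ^ k) (range1 n))

  qbinom : ℕ → ℕ → ℚ
  qbinom n m with m ℕ.≤? n
  ... | yes _ = qpoch n * inv (qpoch m * qpoch (n ℕ.∸ m))
  ... | no _  = 0ℚ

  -- H*_n[s_1,...,s_m] = Σ_{n ≥ k_1 ≥ ... ≥ k_m ≥ 1} ∏ q^{k_j} / [k_j]_q^{s_j}
  Hstar : ℕ → List ℕ → ℚ
  Hstar n [] = 1ℚ
  Hstar n (s ∷ ss) =
    sumℚ (map (λ k → q ^ k * inv (qint k ^ s) * Hstar k ss) (range1 n))

  decSeqs : (m : ℕ) → ℕ → List (Vec ℕ m)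
  decSeqs zero b = [] ∷ []
  decSeqs (suc m) b = concatMap (λ k → map (k ∷_) (decSeqs m (k ℕ.∸ 1))) (range1 b)

  sign : ℕ → ℚ
  sign zero = 1ℚ
  sign (suc k) = - sign k

  factors : {m : ℕ} → Vec ℕ m → Vec ℤ m → Vec ℤ m → ℚ
  factors [] [] [] = 1ℚ
  factors (k ∷ ks) (s ∷ ss) (t ∷ ts) =
    (1ℚ + q ^ k) * (q ^ℤ ((t ℤ.- ℤ.+ 1) ℤ.* ℤ.+ k)) * inv (qint k ^ℤ s)
      * factors ks ss ts

  Hbar : ℕ → (m : ℕ) → Vec ℤ m → Vec ℤ m → ℚ
  Hbar n zero s t = 1ℚ
  Hbar n (suc m) s t = sumℚ (map term (decSeqs (suc m) n))
    where
    term : Vec ℕ (suc m) → ℚ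
    term ks =
      let k₁ = Vec.head ks
          kₘ = Vec.last ks
      in sign kₘ * qbinom n k₁ * inv (qbinom (n ℕ.+ k₁) k₁)
         * q ^ (k₁ ℕ.* k₁ ℕ.∸ (kₘ ℕ.* (kₘ ℕ.∸ 1)) ℕ./ 2)
         * factors ks s t

-- All ways of joining consecutive blocks (a_i, b_i) by "comma" or "plus";
-- plus adds both components simultaneously (so p and p̃ use the same choice).
joinings : ℕ × ℕ → List (ℕ × ℕ) → List (List (ℕ × ℕ))
joinings c [] = (c ∷ []) ∷ []
joinings c (b ∷ bs) =
  map (c ∷_) (joinings b bs)
  ++ joinings (proj₁ c ℕ.+ proj₁ b , proj₂ c ℕ.+ proj₂ b) bs

allPairs : {m : ℕ} → Vec ℕ m → ℕ → List (ℕ × ℕ)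
allPairs [] s' = (2 ℕ.* s' , s') ∷ []
allPairs (x ∷ xs) s' = (2 ℕ.* x ℕ.+ 1 , x ℕ.+ 1) ∷ allPairs xs s'

compositions : {m : ℕ} → Vec ℕ m → ℕ → List (List (ℕ × ℕ))
compositions ss s' with allPairs ss s'
... | [] = []
... | c ∷ cs = joinings c cs

HbarPairs : ℚ → ℕ → List (ℕ × ℕ) → ℚ
HbarPairs q n ps =
  Hbar q n (length ps)
    (Vec.map (λ x → + proj₁ x) (Vec.fromList ps))
    (Vec.map (λ x → + proj₂ x) (Vec.fromList ps))

hArgs : {m : ℕ} → Vec ℕ m → ℕ → List ℕ
hArgs [] s' = replicate s' 2
hArgs (s ∷ ss) s' = replicate s 2 ++ (1 ∷ hArgs ss s')

-- Write C n k = [n, k] / [n + k, k] (q-binomials) and group the sum defining H̄_n[p; p̃] by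
-- its largest index k₁ = k: H̄_n = ∑_k C n k · W(k), where W(k) depends on k and (p, p̃)
-- but not on n. Expanding H*_n by its first argument, H*_n[a, …] = ∑_j q^j/[j]^a H*_j[…], so it
-- suffices to transform ∑_{j ≤ n} q^j/[j]^a ∑_{k ≤ j} C j k w(k) back into the C n k-form.
-- For a = 2 the result is ∑_k C n k · q^k/[k]² w(k), which raises the first block by (2, 1);
-- for a = 1 it is ∑_k C n k · q^k/[k] w(k) (first block raised by (1, 1): a plus) plus
-- ∑_k C n k · (1 + q^k)/[k] q^(k²) ∑_{j < k} q^(-j²) w(j) (a new block (1, 1): a comma).
-- Both follow by induction on n from two relations for C,
--   (C N k - C (N - 1) k) [N]² = C N k q^(N - k) [k]²   and   C N j [N - j] = C N (j + 1) [N + j + 1],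
-- the second one entering through a summation by parts. Starting from
-- H*[∅] = 1 = -H̄_n[0; 0] (a telescoping sum) and prepending the arguments of
-- {2}^{s₁}, 1, …, 1, {2}^{s_{m+1}} from the right produces exactly the comma/plus compositions.

module Submission where

open import Defs
open import Data.Nat using (ℕ; _≤_)
open import Data.Rational using (ℚ; 0ℚ; 1ℚ; _<_; -_)
open import Data.Vec using (Vec)
open import Data.List using (map)
open import Relation.Binary.PropositionalEquality using (_≡_)

open import Data.Nat as ℕ using (zero; suc; z≤n; s≤s)
import Data.Nat.Properties as ℕₚ
import Data.Nat.DivMod as ℕ÷
import Data.Nat.Tactic.RingSolver as ℕ-ring
open import Data.Integer as ℤ using (ℤ; +_)
import Data.Integer.Properties as ℤₚ
open import Data.Rational using (_+_; _*_; _-_; ≢-nonZero; nonNegative) renaming (_≤_ to _≤ℚ_)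
import Data.Rational.Properties as ℚₚ
open import Data.Product using (_×_; _,_; proj₁; proj₂)
open import Data.List using (List; []; _∷_; _++_; concatMap; length; replicate)
import Data.List.Properties as Listₚ
import Data.List.Relation.Unary.All as ListAll
import Data.List.Relation.Unary.All.Properties as ListAllₚ
open import Data.List.NonEmpty using (List⁺; _∷_; _∷⁺_; toList)
open import Data.Vec as Vec using ([]; _∷_)
open import Data.Vec.Relation.Unary.All as All using (All; []; _∷_)
open import Data.Empty using (⊥-elim)
open import Level using (0ℓ)
open import Relation.Binary.PropositionalEquality hiding ([_]; J)
open import Relation.Nullary using (Dec; yes; no; ¬_)
open import Relation.Nullary.Decidable using (dec⇒maybe)
open import Tactic.RingSolver using (solve-∀)
open import Tactic.RingSolver.Core.AlmostCommutativeRing using (AlmostCommutativeRing; fromCommutativeRing)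

ℚ-ring : AlmostCommutativeRing 0ℓ 0ℓ
ℚ-ring = fromCommutativeRing ℚₚ.+-*-commutativeRing (λ x → dec⇒maybe (0ℚ ℚₚ.≟ x))

1≢0 : 1ℚ ≢ 0ℚ
1≢0 ()

*-invʳ : ∀ x → x ≢ 0ℚ → x * inv x ≡ 1ℚ
*-invʳ x x≢0 with x ℚₚ.≟ 0ℚ
... | yes x≡0 = ⊥-elim (x≢0 x≡0)
... | no x≢0′ = ℚₚ.*-inverseʳ x {{≢-nonZero x≢0′}}

*-invˡ : ∀ x → x ≢ 0ℚ → inv x * x ≡ 1ℚ
*-invˡ x x≢0 = trans (ℚₚ.*-comm (inv x) x) (*-invʳ x x≢0)

*-cancelʳ : ∀ d {x y} → d ≢ 0ℚ → x * d ≡ y * d → x ≡ y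
*-cancelʳ d {x} {y} d≢0 xd≡yd = begin
  x                  ≡⟨ unit x ⟩
  (x * d) * inv d    ≡⟨ cong (_* inv d) xd≡yd ⟩
  (y * d) * inv d    ≡⟨ sym (unit y) ⟩
  y                  ∎
  where
  open ≡-Reasoning
  unit : ∀ z → z ≡ (z * d) * inv d
  unit z = begin
    z                  ≡⟨ sym (ℚₚ.*-identityʳ z) ⟩
    z * 1ℚ             ≡⟨ cong (z *_) (sym (*-invʳ d d≢0)) ⟩
    z * (d * inv d)    ≡⟨ sym (ℚₚ.*-assoc z d (inv d)) ⟩
    (z * d) * inv d    ∎

*-≢0 : ∀ {x y} → x ≢ 0ℚ → y ≢ 0ℚ → x * y ≢ 0ℚ
*-≢0 {x} {y} x≢0 y≢0 xy≡0 = y≢0 (*-cancelʳ x x≢0 (begin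
  y * x    ≡⟨ ℚₚ.*-comm y x ⟩
  x * y    ≡⟨ xy≡0 ⟩
  0ℚ       ≡⟨ sym (ℚₚ.*-zeroˡ x) ⟩
  0ℚ * x   ∎))
  where open ≡-Reasoning

solve-for : ∀ {x y z} → y ≢ 0ℚ → x * y ≡ z → x ≡ z * inv y
solve-for {x} {y} {z} y≢0 xy≡z = *-cancelʳ y y≢0 (begin
  x * y                ≡⟨ xy≡z ⟩
  z                    ≡⟨ sym (ℚₚ.*-identityʳ z) ⟩
  z * 1ℚ               ≡⟨ cong (z *_) (sym (*-invˡ y y≢0)) ⟩
  z * (inv y * y)      ≡⟨ sym (ℚₚ.*-assoc z (inv y) y) ⟩
  z * inv y * y        ∎)
  where open ≡-Reasoning

inv-unique : ∀ x y → x ≢ 0ℚ → x * y ≡ 1ℚ → inv x ≡ y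
inv-unique x y x≢0 xy≡1 = *-cancelʳ x x≢0
  (trans (*-invˡ x x≢0) (trans (sym xy≡1) (ℚₚ.*-comm x y)))

inv-≢0 : ∀ {x} → x ≢ 0ℚ → inv x ≢ 0ℚ
inv-≢0 {x} x≢0 inv≡0 = 1≢0 (begin
  1ℚ          ≡⟨ sym (*-invʳ x x≢0) ⟩
  x * inv x   ≡⟨ cong (x *_) inv≡0 ⟩
  x * 0ℚ      ≡⟨ ℚₚ.*-zeroʳ x ⟩
  0ℚ          ∎)
  where open ≡-Reasoning

inv-involutive : ∀ x → inv (inv x) ≡ x
inv-involutive x = by-cases (x ℚₚ.≟ 0ℚ)
  where
  by-cases : Dec (x ≡ 0ℚ) → inv (inv x) ≡ x
  by-cases (yes refl) = refl
  by-cases (no x≢0)  = inv-unique (inv x) x (inv-≢0 x≢0) (*-invˡ x x≢0)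

inv-* : ∀ x y → inv (x * y) ≡ inv x * inv y
inv-* x y = by-cases (x ℚₚ.≟ 0ℚ) (y ℚₚ.≟ 0ℚ)
  where
  swap : ∀ a b c d → (a * b) * (c * d) ≡ (a * c) * (b * d)
  swap = solve-∀ ℚ-ring
  by-cases : Dec (x ≡ 0ℚ) → Dec (y ≡ 0ℚ) → inv (x * y) ≡ inv x * inv y
  by-cases (yes refl) _ = trans (cong inv (ℚₚ.*-zeroˡ y)) (sym (ℚₚ.*-zeroˡ (inv y)))
  by-cases (no _) (yes refl) = trans (cong inv (ℚₚ.*-zeroʳ x)) (sym (ℚₚ.*-zeroʳ (inv x)))
  by-cases (no x≢0) (no y≢0) = inv-unique (x * y) (inv x * inv y) (*-≢0 x≢0 y≢0) (begin
    (x * y) * (inv x * inv y)      ≡⟨ swap x y (inv x) (inv y) ⟩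
    (x * inv x) * (y * inv y)      ≡⟨ cong₂ _*_ (*-invʳ x x≢0) (*-invʳ y y≢0) ⟩
    1ℚ                             ∎)
    where open ≡-Reasoning

inv-*-cancelˡ : ∀ {x} y → x ≢ 0ℚ → inv (x * y) * x ≡ inv y
inv-*-cancelˡ {x} y x≢0 = begin
  inv (x * y) * x          ≡⟨ cong (_* x) (inv-* x y) ⟩
  inv x * inv y * x        ≡⟨ regroup (inv x) (inv y) x ⟩
  inv y * (inv x * x)      ≡⟨ cong (inv y *_) (*-invˡ x x≢0) ⟩
  inv y * 1ℚ               ≡⟨ ℚₚ.*-identityʳ (inv y) ⟩
  inv y                    ∎
  where
  open ≡-Reasoning
  regroup : ∀ a b c → a * b * c ≡ b * (a * c)
  regroup = solve-∀ ℚ-ring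

^-+ : ∀ x m n → x ^ (m ℕ.+ n) ≡ x ^ m * x ^ n
^-+ x zero    n = sym (ℚₚ.*-identityˡ _)
^-+ x (suc m) n = trans (cong (x *_) (^-+ x m n)) (sym (ℚₚ.*-assoc x _ _))

^-≢0 : ∀ {x} n → x ≢ 0ℚ → x ^ n ≢ 0ℚ
^-≢0 zero    x≢0 = 1≢0
^-≢0 (suc n) x≢0 = *-≢0 x≢0 (^-≢0 n x≢0)

^-∸ : ∀ x {m n} → x ≢ 0ℚ → n ≤ m → x ^ (m ℕ.∸ n) ≡ x ^ m * inv (x ^ n)
^-∸ x {m} {n} x≢0 n≤m = solve-for (^-≢0 n x≢0) (begin
  x ^ (m ℕ.∸ n) * x ^ n    ≡⟨ sym (^-+ x (m ℕ.∸ n) n) ⟩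
  x ^ (m ℕ.∸ n ℕ.+ n)      ≡⟨ cong (x ^_) (ℕₚ.m∸n+n≡m n≤m) ⟩
  x ^ m                    ∎)
  where open ≡-Reasoning

qint-+ : ∀ q m n → qint q (m ℕ.+ n) ≡ qint q m + q ^ m * qint q n
qint-+ q m n = begin
  (1ℚ - q ^ (m ℕ.+ n)) * ι              ≡⟨ cong (λ z → (1ℚ - z) * ι) (^-+ q m n) ⟩
  (1ℚ - q ^ m * q ^ n) * ι              ≡⟨ split (q ^ m) (q ^ n) ι ⟩
  (1ℚ - q ^ m) * ι + q ^ m * ((1ℚ - q ^ n) * ι) ∎
  where
  open ≡-Reasoning
  ι = inv (1ℚ - q)
  split : ∀ a b c → (1ℚ - a * b) * c ≡ (1ℚ - a) * c + a * ((1ℚ - b) * c)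
  split = solve-∀ ℚ-ring

^-bounded : ∀ {x} → 0ℚ ≤ℚ x → x ≤ℚ 1ℚ → ∀ k → 0ℚ ≤ℚ x ^ k × x ^ k ≤ℚ 1ℚ
^-bounded     0≤x x≤1 zero    = ℚₚ.≤-trans 0≤x x≤1 , ℚₚ.≤-refl
^-bounded {x} 0≤x x≤1 (suc k) =
  ℚₚ.nonNegative⁻¹ _ {{ℚₚ.nonNeg*nonNeg⇒nonNeg x {{nonNegative 0≤x}} (x ^ k) {{nonNegative 0≤xᵏ}}}} ,
  ℚₚ.≤-trans (ℚₚ.*-monoˡ-≤-nonNeg x {{nonNegative 0≤x}} xᵏ≤1) (ℚₚ.≤-trans (ℚₚ.≤-reflexive (ℚₚ.*-identityʳ x)) x≤1)
  where
  0≤xᵏ = proj₁ (^-bounded 0≤x x≤1 k)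
  xᵏ≤1 = proj₂ (^-bounded 0≤x x≤1 k)

^-suc-<1 : ∀ {x} → 0ℚ ≤ℚ x → x < 1ℚ → ∀ k → x ^ suc k < 1ℚ
^-suc-<1 {x} 0≤x x<1 k = ℚₚ.≤-<-trans
  (ℚₚ.≤-trans (ℚₚ.*-monoˡ-≤-nonNeg x {{nonNegative 0≤x}} (proj₂ (^-bounded 0≤x (ℚₚ.<⇒≤ x<1) k))) (ℚₚ.≤-reflexive (ℚₚ.*-identityʳ x)))
  x<1

<1⇒1-≢0 : ∀ {x} → x < 1ℚ → 1ℚ - x ≢ 0ℚ
<1⇒1-≢0 {x} x<1 1-x≡0 = ℚₚ.<-irrefl (trans (double-negation x) (cong (λ y → 1ℚ - y) 1-x≡0)) x<1
  where
  double-negation : ∀ x → x ≡ 1ℚ - (1ℚ - x)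
  double-negation = solve-∀ ℚ-ring

triangle : ℕ → ℕ
triangle zero    = 0
triangle (suc k) = k ℕ.+ triangle k

triangle-double : ∀ k → triangle k ℕ.* 2 ℕ.+ k ≡ k ℕ.* k
triangle-double zero    = refl
triangle-double (suc k) = begin
  (k ℕ.+ triangle k) ℕ.* 2 ℕ.+ suc k          ≡⟨ regroup k (triangle k) ⟩
  (triangle k ℕ.* 2 ℕ.+ k) ℕ.+ (k ℕ.+ suc k)  ≡⟨ cong (ℕ._+ (k ℕ.+ suc k)) (triangle-double k) ⟩
  k ℕ.* k ℕ.+ (k ℕ.+ suc k)                   ≡⟨ square k ⟩
  suc k ℕ.* suc k                             ∎
  where
  open ≡-Reasoning
  regroup : ∀ k t → (k ℕ.+ t) ℕ.* 2 ℕ.+ suc k ≡ (t ℕ.* 2 ℕ.+ k) ℕ.+ (k ℕ.+ suc k)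
  regroup = ℕ-ring.solve-∀
  square : ∀ k → k ℕ.* k ℕ.+ (k ℕ.+ suc k) ≡ suc k ℕ.* suc k
  square = ℕ-ring.solve-∀

half-k[k-1]≡triangle : ∀ k → (k ℕ.* (k ℕ.∸ 1)) ℕ./ 2 ≡ triangle k
half-k[k-1]≡triangle k = trans (cong (ℕ._/ 2) (k[k-1]≡ k)) (ℕ÷.m*n/n≡m (triangle k) 2)
  where
  k[k-1]≡ : ∀ k → k ℕ.* (k ℕ.∸ 1) ≡ triangle k ℕ.* 2
  k[k-1]≡ zero    = refl
  k[k-1]≡ (suc k) = begin
    suc k ℕ.* k                        ≡⟨ expand k ⟩
    k ℕ.+ k ℕ.* k                      ≡⟨ cong (k ℕ.+_) (sym (triangle-double k)) ⟩
    k ℕ.+ (triangle k ℕ.* 2 ℕ.+ k)     ≡⟨ regroup k (triangle k) ⟩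
    (k ℕ.+ triangle k) ℕ.* 2           ∎
    where
    open ≡-Reasoning
    expand : ∀ k → suc k ℕ.* k ≡ k ℕ.+ k ℕ.* k
    expand = ℕ-ring.solve-∀
    regroup : ∀ k t → k ℕ.+ (t ℕ.* 2 ℕ.+ k) ≡ (k ℕ.+ t) ℕ.* 2
    regroup = ℕ-ring.solve-∀

square∸triangle : ∀ k → k ℕ.* k ℕ.∸ triangle k ≡ triangle k ℕ.+ k
square∸triangle k = begin
  k ℕ.* k ℕ.∸ triangle k                          ≡⟨ cong (ℕ._∸ triangle k) (sym (triangle-double k)) ⟩
  triangle k ℕ.* 2 ℕ.+ k ℕ.∸ triangle k           ≡⟨ cong (ℕ._∸ triangle k) (regroup (triangle k) k) ⟩
  triangle k ℕ.+ (triangle k ℕ.+ k) ℕ.∸ triangle k ≡⟨ ℕₚ.m+n∸m≡n (triangle k) _ ⟩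
  triangle k ℕ.+ k                                ∎
  where
  open ≡-Reasoning
  regroup : ∀ t k → t ℕ.* 2 ℕ.+ k ≡ t ℕ.+ (t ℕ.+ k)
  regroup = ℕ-ring.solve-∀

triangle≤square : ∀ k → triangle k ≤ k ℕ.* k
triangle≤square k =
  subst (triangle k ≤_) (trans (regroup (triangle k) k) (triangle-double k)) (ℕₚ.m≤m+n (triangle k) (triangle k ℕ.+ k))
  where
  regroup : ∀ t k → t ℕ.+ (t ℕ.+ k) ≡ t ℕ.* 2 ℕ.+ k
  regroup = ℕ-ring.solve-∀

by-offset : (R : ℕ → ℕ → Set) → (∀ i j → R (i ℕ.+ j) j) → ∀ n j → j ≤ n → R n j
by-offset R r n j j≤n = subst (λ m → R m j) (ℕₚ.m∸n+n≡m j≤n) (r (n ℕ.∸ j) j)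

last-≤ : ∀ {m b} (ks : Vec ℕ (suc m)) → All (_≤ b) ks → Vec.last ks ≤ b
last-≤ (k ∷ [])      (k≤b ∷ [])  = k≤b
last-≤ (k ∷ k′ ∷ ks) (_ ∷ ks≤b) = last-≤ (k′ ∷ ks) ks≤b

range1-bounded : ∀ b → ListAll.All (_≤ b) (range1 b)
range1-bounded zero    = ListAll.[]
range1-bounded (suc b) = ListAllₚ.++⁺ (ListAll.map ℕₚ.m≤n⇒m≤1+n (range1-bounded b)) (ℕₚ.≤-refl ListAll.∷ ListAll.[])

sumℚ-++ : ∀ xs ys → sumℚ (xs ++ ys) ≡ sumℚ xs + sumℚ ys
sumℚ-++ []       ys = sym (ℚₚ.+-identityˡ _)
sumℚ-++ (x ∷ xs) ys = trans (cong (_+_ x) (sumℚ-++ xs ys)) (sym (ℚₚ.+-assoc x _ _))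

prodℚ-++ : ∀ xs ys → prodℚ (xs ++ ys) ≡ prodℚ xs * prodℚ ys
prodℚ-++ []       ys = sym (ℚₚ.*-identityˡ _)
prodℚ-++ (x ∷ xs) ys = trans (cong (x *_) (prodℚ-++ xs ys)) (sym (ℚₚ.*-assoc x _ _))

sumℚ-map-cong : ∀ {A : Set} {f g : A → ℚ} xs → (∀ x → f x ≡ g x) → sumℚ (map f xs) ≡ sumℚ (map g xs)
sumℚ-map-cong xs f≗g = cong sumℚ (Listₚ.map-cong f≗g xs)

sumℚ-map-∘ : ∀ {A B : Set} (f : B → ℚ) (g : A → B) xs → sumℚ (map f (map g xs)) ≡ sumℚ (map (λ x → f (g x)) xs)
sumℚ-map-∘ f g xs = cong sumℚ (sym (Listₚ.map-∘ xs))

sumℚ-concatMap : ∀ {A B : Set} (f : B → ℚ) (g : A → List B) xs →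
  sumℚ (map f (concatMap g xs)) ≡ sumℚ (map (λ x → sumℚ (map f (g x))) xs)
sumℚ-concatMap f g []       = refl
sumℚ-concatMap f g (x ∷ xs) = begin
  sumℚ (map f (g x ++ concatMap g xs))                  ≡⟨ cong sumℚ (Listₚ.map-++ f (g x) _) ⟩
  sumℚ (map f (g x) ++ map f (concatMap g xs))          ≡⟨ sumℚ-++ (map f (g x)) _ ⟩
  sumℚ (map f (g x)) + sumℚ (map f (concatMap g xs))    ≡⟨ cong (_+_ (sumℚ (map f (g x)))) (sumℚ-concatMap f g xs) ⟩
  sumℚ (map (λ x → sumℚ (map f (g x))) (x ∷ xs))        ∎
  where open ≡-Reasoning

sumℚ-map-*ˡ : ∀ {A : Set} a (f : A → ℚ) xs → sumℚ (map (λ x → a * f x) xs) ≡ a * sumℚ (map f xs)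
sumℚ-map-*ˡ a f []       = sym (ℚₚ.*-zeroʳ a)
sumℚ-map-*ˡ a f (x ∷ xs) = trans (cong (_+_ (a * f x)) (sumℚ-map-*ˡ a f xs)) (sym (ℚₚ.*-distribˡ-+ a _ _))

sumℚ-map-+ : ∀ {A : Set} (f g : A → ℚ) xs → sumℚ (map (λ x → f x + g x) xs) ≡ sumℚ (map f xs) + sumℚ (map g xs)
sumℚ-map-+ f g []       = refl
sumℚ-map-+ f g (x ∷ xs) = trans (cong (_+_ (f x + g x)) (sumℚ-map-+ f g xs)) (interchange (f x) (g x) _ _)
  where
  interchange : ∀ a b c d → a + b + (c + d) ≡ a + c + (b + d)
  interchange = solve-∀ ℚ-ring

sumℚ-map-prepend : ∀ {m} (f : Vec ℕ (suc m) → ℚ) (g : Vec ℕ m → ℚ) c k xs →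
  (∀ ks → f (k ∷ ks) ≡ c * g ks) → sumℚ (map f (map (k ∷_) xs)) ≡ c * sumℚ (map g xs)
sumℚ-map-prepend f g c k xs f≗cg = trans (sumℚ-map-∘ f (k ∷_) xs) (trans (sumℚ-map-cong xs f≗cg) (sumℚ-map-*ˡ c g xs))

∑ : ℕ → (ℕ → ℚ) → ℚ
∑ zero    f = 0ℚ
∑ (suc n) f = ∑ n f + f (suc n)

sumℚ-range1 : ∀ n f → sumℚ (map f (range1 n)) ≡ ∑ n f
sumℚ-range1 zero    f = refl
sumℚ-range1 (suc n) f = begin
  sumℚ (map f (range1 n ++ suc n ∷ []))            ≡⟨ cong sumℚ (Listₚ.map-++ f (range1 n) _) ⟩
  sumℚ (map f (range1 n) ++ f (suc n) ∷ [])        ≡⟨ sumℚ-++ (map f (range1 n)) _ ⟩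
  sumℚ (map f (range1 n)) + (f (suc n) + 0ℚ)       ≡⟨ cong₂ _+_ (sumℚ-range1 n f) (ℚₚ.+-identityʳ _) ⟩
  ∑ n f + f (suc n)                                ∎
  where open ≡-Reasoning

∑-cong : ∀ n {f g} → (∀ k → suc k ≤ n → f (suc k) ≡ g (suc k)) → ∑ n f ≡ ∑ n g
∑-cong zero    f≗g = refl
∑-cong (suc n) f≗g = cong₂ _+_ (∑-cong n (λ k k<n → f≗g k (ℕₚ.m≤n⇒m≤1+n k<n))) (f≗g n ℕₚ.≤-refl)

∑-+ : ∀ n f g → ∑ n (λ k → f k + g k) ≡ ∑ n f + ∑ n g
∑-+ zero    f g = refl
∑-+ (suc n) f g = trans (cong (_+ (f (suc n) + g (suc n))) (∑-+ n f g)) (interchange (∑ n f) (∑ n g) _ _)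
  where
  interchange : ∀ a b c d → a + b + (c + d) ≡ a + c + (b + d)
  interchange = solve-∀ ℚ-ring

∑-*ˡ : ∀ n a f → ∑ n (λ k → a * f k) ≡ a * ∑ n f
∑-*ˡ zero    a f = sym (ℚₚ.*-zeroʳ a)
∑-*ˡ (suc n) a f = trans (cong (_+ a * f (suc n)) (∑-*ˡ n a f)) (sym (ℚₚ.*-distribˡ-+ a _ _))

∑-neg : ∀ n f → ∑ n (λ k → - f k) ≡ - ∑ n f
∑-neg zero    f = refl
∑-neg (suc n) f = trans (cong (_+ - f (suc n)) (∑-neg n f)) (sym (ℚₚ.neg-distrib-+ (∑ n f) _))

∑-sumℚ-comm : ∀ {A : Set} n (h : ℕ → A → ℚ) xs →
  ∑ n (λ k → sumℚ (map (h k) xs)) ≡ sumℚ (map (λ x → ∑ n (λ k → h k x)) xs)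
∑-sumℚ-comm zero    h []       = refl
∑-sumℚ-comm (suc n) h []       = trans (ℚₚ.+-identityʳ _) (∑-sumℚ-comm n h [])
∑-sumℚ-comm n       h (x ∷ xs) =
  trans (∑-+ n (λ k → h k x) _) (cong (_+_ (∑ n (λ k → h k x))) (∑-sumℚ-comm n h xs))

∑-*-neg-sumℚ : ∀ {A : Set} n (a : ℕ → ℚ) (h : ℕ → A → ℚ) xs →
  ∑ n (λ k → a k * - sumℚ (map (h k) xs)) ≡ - sumℚ (map (λ x → ∑ n (λ k → a k * h k x)) xs)
∑-*-neg-sumℚ n a h xs = begin
  ∑ n (λ k → a k * - sumℚ (map (h k) xs))
    ≡⟨ ∑-cong n (λ k _ → sym (ℚₚ.neg-distribʳ-* (a (suc k)) _)) ⟩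
  ∑ n (λ k → - (a k * sumℚ (map (h k) xs)))
    ≡⟨ ∑-neg n _ ⟩
  - ∑ n (λ k → a k * sumℚ (map (h k) xs))
    ≡⟨ cong -_ (∑-cong n (λ k _ → sym (sumℚ-map-*ˡ (a (suc k)) (h (suc k)) xs))) ⟩
  - ∑ n (λ k → sumℚ (map (λ x → a k * h k x) xs))
    ≡⟨ cong -_ (∑-sumℚ-comm n (λ k x → a k * h k x) xs) ⟩
  - sumℚ (map (λ x → ∑ n (λ k → a k * h k x)) xs) ∎
  where open ≡-Reasoning

∑-telescope : ∀ n (F : ℕ → ℚ) → ∑ n (λ k → F k - F (ℕ.pred k)) ≡ F n - F 0
∑-telescope zero    F = sym (ℚₚ.+-inverseʳ (F 0))
∑-telescope (suc n) F = trans (cong (_+ (F (suc n) - F n)) (∑-telescope n F)) (collapse (F 0) (F n) (F (suc n)))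
  where
  collapse : ∀ a b c → b - a + (c - b) ≡ c - a
  collapse = solve-∀ ℚ-ring

∑-triangle : ∀ n (a b : ℕ → ℚ) → ∑ n (λ k → a k * ∑ (ℕ.pred k) b) ≡ ∑ n (λ j → b j * (∑ n a - ∑ j a))
∑-triangle zero    a b = refl
∑-triangle (suc n) a b = begin
  ∑ n (λ k → a k * ∑ (ℕ.pred k) b) + a (suc n) * ∑ n b
    ≡⟨ cong₂ _+_ (∑-triangle n a b) (sym (∑-*ˡ n (a (suc n)) b)) ⟩
  ∑ n (λ j → b j * (∑ n a - ∑ j a)) + ∑ n (λ j → a (suc n) * b j)
    ≡⟨ sym (∑-+ n _ _) ⟩
  ∑ n (λ j → b j * (∑ n a - ∑ j a) + a (suc n) * b j)
    ≡⟨ ∑-cong n (λ j _ → extend (b (suc j)) (∑ n a) (a (suc n)) (∑ (suc j) a)) ⟩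
  ∑ n (λ j → b j * (∑ (suc n) a - ∑ j a))
    ≡⟨ sym (vanish (∑ n (λ j → b j * (∑ (suc n) a - ∑ j a))) (b (suc n)) (∑ (suc n) a)) ⟩
  ∑ n (λ j → b j * (∑ (suc n) a - ∑ j a)) + b (suc n) * (∑ (suc n) a - ∑ (suc n) a) ∎
  where
  open ≡-Reasoning
  extend : ∀ w x z y → w * (x - y) + z * w ≡ w * (x + z - y)
  extend = solve-∀ ℚ-ring
  vanish : ∀ s w x → s + w * (x - x) ≡ s
  vanish = solve-∀ ℚ-ring

∑-split : ∀ n G (V : ℕ → ℚ) → (∀ j → suc j ≤ n → V j ≡ V (suc j) + G (suc j)) → V n ≡ 0ℚ →
  ∀ j → j ≤ n → ∑ n G ≡ ∑ j G + V j
∑-split n G V step Vn≡0 j j≤n = go (n ℕ.∸ j) j (ℕₚ.m∸n+n≡m j≤n)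
  where
  reassoc : ∀ a b c → a + b + c ≡ a + (c + b)
  reassoc = solve-∀ ℚ-ring
  go : ∀ d j → d ℕ.+ j ≡ n → ∑ n G ≡ ∑ j G + V j
  go zero j refl = sym (trans (cong (_+_ (∑ j G)) Vn≡0) (ℚₚ.+-identityʳ _))
  go (suc d) j d+j≡n = begin
    ∑ n G                               ≡⟨ go d (suc j) (trans (ℕₚ.+-suc d j) d+j≡n) ⟩
    ∑ j G + G (suc j) + V (suc j)       ≡⟨ reassoc (∑ j G) (G (suc j)) (V (suc j)) ⟩
    ∑ j G + (V (suc j) + G (suc j))     ≡⟨ cong (_+_ (∑ j G)) (sym (step j (subst (suc j ≤_) d+j≡n (s≤s (ℕₚ.m≤n+m j d))))) ⟩
    ∑ j G + V j                         ∎
    where open ≡-Reasoning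

∑-by-parts : ∀ n (a b V : ℕ → ℚ) → (∀ j → suc j ≤ n → V j ≡ V (suc j) + a (suc j)) → V n ≡ 0ℚ →
  ∑ n (λ k → a k * ∑ (ℕ.pred k) b) ≡ ∑ n (λ j → b j * V j)
∑-by-parts n a b V step Vn≡0 = trans (∑-triangle n a b) (∑-cong n tail)
  where
  tail : ∀ j → suc j ≤ n → b (suc j) * (∑ n a - ∑ (suc j) a) ≡ b (suc j) * V (suc j)
  tail j j<n = trans (cong (λ s → b (suc j) * (s - ∑ (suc j) a)) (∑-split n a V step Vn≡0 (suc j) j<n))
                     (cong (b (suc j) *_) (cancel (∑ (suc j) a) (V (suc j))))
    where
    cancel : ∀ x v → x + v - x ≡ v
    cancel = solve-∀ ℚ-ring

Pair : Set
Pair = ℕ × ℕ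

_⊕_ : Pair → Pair → Pair
c ⊕ d = proj₁ c ℕ.+ proj₁ d , proj₂ c ℕ.+ proj₂ d

⊕-assoc : ∀ b c d → (b ⊕ c) ⊕ d ≡ b ⊕ (c ⊕ d)
⊕-assoc b c d = cong₂ _,_ (ℕₚ.+-assoc (proj₁ b) _ _) (ℕₚ.+-assoc (proj₂ b) _ _)

⊕-head : Pair → List Pair → List Pair
⊕-head c []       = []
⊕-head c (d ∷ ds) = (c ⊕ d) ∷ ds

joinings-⊕ : ∀ c b bs → joinings (c ⊕ b) bs ≡ map (⊕-head c) (joinings b bs)
joinings-⊕ c b []        = refl
joinings-⊕ c b (b′ ∷ bs) = begin
  map ((c ⊕ b) ∷_) (joinings b′ bs) ++ joinings ((c ⊕ b) ⊕ b′) bs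
    ≡⟨ cong₂ _++_ (Listₚ.map-∘ (joinings b′ bs)) (cong (λ d → joinings d bs) (⊕-assoc c b b′)) ⟩
  map (⊕-head c) (map (b ∷_) (joinings b′ bs)) ++ joinings (c ⊕ (b ⊕ b′)) bs
    ≡⟨ cong (map (⊕-head c) (map (b ∷_) (joinings b′ bs)) ++_) (joinings-⊕ c (b ⊕ b′) bs) ⟩
  map (⊕-head c) (map (b ∷_) (joinings b′ bs)) ++ map (⊕-head c) (joinings (b ⊕ b′) bs)
    ≡⟨ sym (Listₚ.map-++ (⊕-head c) (map (b ∷_) (joinings b′ bs)) _) ⟩
  map (⊕-head c) (map (b ∷_) (joinings b′ bs) ++ joinings (b ⊕ b′) bs) ∎
  where open ≡-Reasoning

oddPair : ℕ → Pair
oddPair x = 2 ℕ.* x ℕ.+ 1 , x ℕ.+ 1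

compositions-∷ : ∀ {m} x (xs : Vec ℕ m) s′ →
  compositions (x ∷ xs) s′ ≡ map (oddPair x ∷_) (compositions xs s′) ++ map (⊕-head (oddPair x)) (compositions xs s′)
compositions-∷ x []       s′ = refl
compositions-∷ x (y ∷ ys) s′ = cong (map (oddPair x ∷_) (compositions (y ∷ ys) s′) ++_) (joinings-⊕ (oddPair x) (oddPair y) (allPairs ys s′))

comma : Pair → List⁺ Pair → List⁺ Pair
comma c B = c ∷⁺ B

plus : Pair → List⁺ Pair → List⁺ Pair
plus c (d ∷ ds) = (c ⊕ d) ∷ ds

blocks : ∀ {m} → Vec ℕ m → ℕ → List (List⁺ Pair)
blocks []       s′ = ((2 ℕ.* s′ , s′) ∷ []) ∷ []
blocks (x ∷ xs) s′ = map (comma (oddPair x)) (blocks xs s′) ++ map (plus (oddPair x)) (blocks xs s′)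

blocks-compositions : ∀ {m} (s : Vec ℕ m) s′ → map toList (blocks s s′) ≡ compositions s s′
blocks-compositions []       s′ = refl
blocks-compositions (x ∷ xs) s′ = begin
  map toList (map (comma (oddPair x)) Bs ++ map (plus (oddPair x)) Bs)
    ≡⟨ Listₚ.map-++ toList (map (comma (oddPair x)) Bs) _ ⟩
  map toList (map (comma (oddPair x)) Bs) ++ map toList (map (plus (oddPair x)) Bs)
    -- toList ∘ comma c = (c ∷_) ∘ toList and toList ∘ plus c = ⊕-head c ∘ toList hold definitionally
    ≡⟨ cong₂ _++_ (trans (sym (Listₚ.map-∘ Bs)) (Listₚ.map-∘ Bs)) (trans (sym (Listₚ.map-∘ Bs)) (Listₚ.map-∘ Bs)) ⟩
  map (oddPair x ∷_) (map toList Bs) ++ map (⊕-head (oddPair x)) (map toList Bs)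
    ≡⟨ cong (λ cs → map (oddPair x ∷_) cs ++ map (⊕-head (oddPair x)) cs) (blocks-compositions xs s′) ⟩
  map (oddPair x ∷_) (compositions xs s′) ++ map (⊕-head (oddPair x)) (compositions xs s′)
    ≡⟨ sym (compositions-∷ x xs s′) ⟩
  compositions (x ∷ xs) s′ ∎
  where
  open ≡-Reasoning
  Bs = blocks xs s′

module _ (q : ℚ) (q≢0 : q ≢ 0ℚ) (1-q^suc≢0 : ∀ k → 1ℚ - q ^ suc k ≢ 0ℚ) where

  [_] : ℕ → ℚ
  [ k ] = qint q k

  1-q≢0 : 1ℚ - q ≢ 0ℚ
  1-q≢0 1-q≡0 = 1-q^suc≢0 0 (trans (cong (λ x → 1ℚ - x) (ℚₚ.*-identityʳ q)) 1-q≡0)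

  [suc]≢0 : ∀ k → [ suc k ] ≢ 0ℚ
  [suc]≢0 k = *-≢0 (1-q^suc≢0 k) (inv-≢0 1-q≢0)

  P : ℕ → ℚ
  P = qpoch q

  P-suc : ∀ n → P (suc n) ≡ P n * (1ℚ - q ^ suc n)
  P-suc n = begin
    prodℚ (map f (range1 n ++ suc n ∷ []))        ≡⟨ cong prodℚ (Listₚ.map-++ f (range1 n) _) ⟩
    prodℚ (map f (range1 n) ++ f (suc n) ∷ [])    ≡⟨ prodℚ-++ (map f (range1 n)) _ ⟩
    P n * (f (suc n) * 1ℚ)                        ≡⟨ cong (P n *_) (ℚₚ.*-identityʳ _) ⟩
    P n * (1ℚ - q ^ suc n)                        ∎
    where
    open ≡-Reasoning
    f : ℕ → ℚ
    f k = 1ℚ - q ^ k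

  P-≢0 : ∀ n → P n ≢ 0ℚ
  P-≢0 zero    = 1≢0
  P-≢0 (suc n) Pn≡0 = *-≢0 (P-≢0 n) (1-q^suc≢0 n) (trans (sym (P-suc n)) Pn≡0)

  qbinom-≤ : ∀ {n k} → k ≤ n → qbinom q n k ≡ P n * inv (P k * P (n ℕ.∸ k))
  qbinom-≤ {n} {k} k≤n with k ℕ.≤? n
  ... | yes _  = refl
  ... | no k≰n = ⊥-elim (k≰n k≤n)

  qbinom-> : ∀ {n k} → ¬ k ≤ n → qbinom q n k ≡ 0ℚ
  qbinom-> {n} {k} k≰n with k ℕ.≤? n
  ... | yes k≤n = ⊥-elim (k≰n k≤n)
  ... | no _    = refl

  qbinom-zero : ∀ m → qbinom q m 0 ≡ 1ℚ
  qbinom-zero m = trans (qbinom-≤ {m} z≤n)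
    (trans (cong (λ z → P m * inv z) (ℚₚ.*-identityˡ (P m))) (*-invʳ (P m) (P-≢0 m)))

  C : ℕ → ℕ → ℚ
  C n k = qbinom q n k * inv (qbinom q (n ℕ.+ k) k)

  C-zero : ∀ n → C n 0 ≡ 1ℚ
  C-zero n = cong₂ (λ x y → x * inv y) (qbinom-zero n) (qbinom-zero (n ℕ.+ 0))

  C-suc-self : ∀ n → C n (suc n) ≡ 0ℚ
  C-suc-self n = trans (cong (_* inv (qbinom q (n ℕ.+ suc n) (suc n))) (qbinom-> (ℕₚ.n≮n n)))
                       (ℚₚ.*-zeroˡ (inv (qbinom q (n ℕ.+ suc n) (suc n))))

  C-closed : ∀ j k → C (j ℕ.+ k) k * (P j * P (j ℕ.+ k ℕ.+ k)) ≡ P (j ℕ.+ k) * P (j ℕ.+ k)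
  C-closed j k = begin
    C n k * (P j * P (n ℕ.+ k))
      ≡⟨ cong₂ (λ x y → x * inv y * (P j * P (n ℕ.+ k))) (qbinom-≤ (ℕₚ.m≤n+m k j)) (qbinom-≤ (ℕₚ.m≤n+m k n)) ⟩
    P n * inv (P k * P (n ℕ.∸ k)) * inv (P (n ℕ.+ k) * inv (P k * P (n ℕ.+ k ℕ.∸ k))) * (P j * P (n ℕ.+ k))
      ≡⟨ cong₂ (λ x y → P n * inv (P k * P x) * inv (P (n ℕ.+ k) * inv (P k * P y)) * (P j * P (n ℕ.+ k)))
               (ℕₚ.m+n∸n≡m j k) (ℕₚ.m+n∸n≡m n k) ⟩
    P n * inv (P k * P j) * inv (P (n ℕ.+ k) * inv (P k * P n)) * (P j * P (n ℕ.+ k))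
      ≡⟨ cong₂ (λ x y → P n * x * y * (P j * P (n ℕ.+ k)))
               (inv-* (P k) (P j)) (trans (inv-* (P (n ℕ.+ k)) _) (cong (inv (P (n ℕ.+ k)) *_) (inv-involutive _))) ⟩
    P n * (inv (P k) * inv (P j)) * (inv (P (n ℕ.+ k)) * (P k * P n)) * (P j * P (n ℕ.+ k))
      ≡⟨ regroup (P n) (P k) (P j) (P (n ℕ.+ k)) (inv (P k)) (inv (P j)) (inv (P (n ℕ.+ k))) ⟩
    P n * P n * ((inv (P k) * P k) * (inv (P j) * P j) * (inv (P (n ℕ.+ k)) * P (n ℕ.+ k)))
      ≡⟨ cong (P n * P n *_) (cong₂ _*_ (cong₂ _*_ (*-invˡ _ (P-≢0 k)) (*-invˡ _ (P-≢0 j))) (*-invˡ _ (P-≢0 (n ℕ.+ k)))) ⟩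
    P n * P n * 1ℚ
      ≡⟨ ℚₚ.*-identityʳ _ ⟩
    P n * P n ∎
    where
    open ≡-Reasoning
    n = j ℕ.+ k
    regroup : ∀ A K B D iK iB iD → A * (iK * iB) * (iD * (K * A)) * (B * D) ≡ A * A * ((iK * K) * (iB * B) * (iD * D))
    regroup = solve-∀ ℚ-ring

  C-ratio : ∀ j k → C (suc (j ℕ.+ k)) k * ((1ℚ - q ^ suc j) * (1ℚ - q ^ suc (j ℕ.+ k ℕ.+ k)))
                  ≡ C (j ℕ.+ k) k * ((1ℚ - q ^ suc (j ℕ.+ k)) * (1ℚ - q ^ suc (j ℕ.+ k)))
  C-ratio j k = *-cancelʳ (P j * P (n ℕ.+ k)) (*-≢0 (P-≢0 j) (P-≢0 (n ℕ.+ k))) (begin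
    C (suc n) k * (a * c) * (P j * P (n ℕ.+ k))
      ≡⟨ shuffle (C (suc n) k) a c (P j) (P (n ℕ.+ k)) ⟩
    C (suc n) k * ((P j * a) * (P (n ℕ.+ k) * c))
      ≡⟨ cong₂ (λ x y → C (suc n) k * (x * y)) (sym (P-suc j)) (sym (P-suc (n ℕ.+ k))) ⟩
    C (suc n) k * (P (suc j) * P (suc (n ℕ.+ k)))
      ≡⟨ C-closed (suc j) k ⟩
    P (suc n) * P (suc n)
      ≡⟨ cong (λ x → x * x) (P-suc n) ⟩
    (P n * b) * (P n * b)
      ≡⟨ square-* (P n) b ⟩
    P n * P n * (b * b)
      ≡⟨ cong (_* (b * b)) (sym (C-closed j k)) ⟩
    C n k * (P j * P (n ℕ.+ k)) * (b * b)
      ≡⟨ swap (C n k) (P j * P (n ℕ.+ k)) (b * b) ⟩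
    C n k * (b * b) * (P j * P (n ℕ.+ k)) ∎)
    where
    open ≡-Reasoning
    n = j ℕ.+ k
    a = 1ℚ - q ^ suc j
    b = 1ℚ - q ^ suc n
    c = 1ℚ - q ^ suc (n ℕ.+ k)
    shuffle : ∀ C a c A B → C * (a * c) * (A * B) ≡ C * ((A * a) * (B * c))
    shuffle = solve-∀ ℚ-ring
    square-* : ∀ x y → (x * y) * (x * y) ≡ x * x * (y * y)
    square-* = solve-∀ ℚ-ring
    swap : ∀ x y z → x * y * z ≡ x * z * y
    swap = solve-∀ ℚ-ring

  q^-split : ∀ i j → q ^ suc (i ℕ.+ j) ≡ q ^ i * q ^ suc j
  q^-split i j = trans (cong (q ^_) (sym (ℕₚ.+-suc i j))) (^-+ q i (suc j))

  []-split : ∀ i j → [ suc (i ℕ.+ j) ] ≡ [ suc j ] + q ^ suc j * [ i ]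
  []-split i j = trans (cong (λ m → [ suc m ]) (ℕₚ.+-comm i j)) (qint-+ q (suc j) i)

  []-split₂ : ∀ i j → [ suc (suc (i ℕ.+ j) ℕ.+ j) ] ≡ [ suc j ] + q ^ suc j * [ suc (i ℕ.+ j) ]
  []-split₂ i j = trans (cong (λ m → [ suc m ]) (ℕₚ.+-comm (suc (i ℕ.+ j)) j)) (qint-+ q (suc j) (suc (i ℕ.+ j)))

  C-difference : ∀ i j → (C (suc (i ℕ.+ j)) (suc j) - C (i ℕ.+ j) (suc j)) * [ suc (i ℕ.+ j) ] ^ 2
                        ≡ C (suc (i ℕ.+ j)) (suc j) * q ^ i * [ suc j ] ^ 2
  C-difference zero j = begin
    (C (suc j) (suc j) - C j (suc j)) * [ suc j ] ^ 2  ≡⟨ cong (λ z → (C (suc j) (suc j) - z) * [ suc j ] ^ 2) (C-suc-self j) ⟩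
    (C (suc j) (suc j) - 0ℚ) * [ suc j ] ^ 2          ≡⟨ drop-zero (C (suc j) (suc j)) ([ suc j ] ^ 2) ⟩
    C (suc j) (suc j) * 1ℚ * [ suc j ] ^ 2            ∎
    where
    open ≡-Reasoning
    drop-zero : ∀ c x → (c - 0ℚ) * x ≡ c * 1ℚ * x
    drop-zero = solve-∀ ℚ-ring
  C-difference (suc i) j =
    subst (λ n → (C (suc n) (suc j) - C n (suc j)) * [ suc n ] ^ 2 ≡ C (suc n) (suc j) * a * [ suc j ] ^ 2)
          (ℕₚ.+-suc i j)
          (trans (cong (λ z → (C (suc n) (suc j) - C n (suc j)) * ((1ℚ - z) * ι * ((1ℚ - z) * ι * 1ℚ))) q^n≡ab)
                 (ratio⇒difference (C (suc n) (suc j)) (C n (suc j)) a b ι ratio))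
    where
    n = i ℕ.+ suc j
    a = q ^ suc i
    b = q ^ suc j
    ι = inv (1ℚ - q)
    q^n≡ab : q ^ suc n ≡ a * b
    q^n≡ab = ^-+ q (suc i) (suc j)
    q^n+k≡abb : q ^ suc (n ℕ.+ suc j) ≡ a * b * b
    q^n+k≡abb = trans (^-+ q (suc n) (suc j)) (cong (_* b) q^n≡ab)
    ratio : C (suc n) (suc j) * ((1ℚ - a) * (1ℚ - a * b * b)) ≡ C n (suc j) * ((1ℚ - a * b) * (1ℚ - a * b))
    ratio = trans (cong (λ z → C (suc n) (suc j) * ((1ℚ - a) * (1ℚ - z))) (sym q^n+k≡abb))
           (trans (C-ratio i (suc j)) (cong (λ z → C n (suc j) * ((1ℚ - z) * (1ℚ - z))) q^n≡ab))
    ratio⇒difference : ∀ c′ c a b ι → c′ * ((1ℚ - a) * (1ℚ - a * b * b)) ≡ c * ((1ℚ - a * b) * (1ℚ - a * b)) →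
      (c′ - c) * ((1ℚ - a * b) * ι * ((1ℚ - a * b) * ι * 1ℚ)) ≡ c′ * a * ((1ℚ - b) * ι * ((1ℚ - b) * ι * 1ℚ))
    ratio⇒difference c′ c a b ι r = begin
      (c′ - c) * ((1ℚ - a * b) * ι * ((1ℚ - a * b) * ι * 1ℚ))
        ≡⟨ expand c′ c (1ℚ - a * b) ι ⟩
      c′ * ((1ℚ - a * b) * (1ℚ - a * b)) * (ι * ι) - c * ((1ℚ - a * b) * (1ℚ - a * b)) * (ι * ι)
        ≡⟨ cong (λ z → c′ * ((1ℚ - a * b) * (1ℚ - a * b)) * (ι * ι) - z * (ι * ι)) (sym r) ⟩
      c′ * ((1ℚ - a * b) * (1ℚ - a * b)) * (ι * ι) - c′ * ((1ℚ - a) * (1ℚ - a * b * b)) * (ι * ι)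
        ≡⟨ collect c′ a b ι ⟩
      c′ * a * ((1ℚ - b) * ι * ((1ℚ - b) * ι * 1ℚ)) ∎
      where
      open ≡-Reasoning
      expand : ∀ c′ c x ι → (c′ - c) * (x * ι * (x * ι * 1ℚ)) ≡ c′ * (x * x) * (ι * ι) - c * (x * x) * (ι * ι)
      expand = solve-∀ ℚ-ring
      collect : ∀ c′ a b ι → c′ * ((1ℚ - a * b) * (1ℚ - a * b)) * (ι * ι) - c′ * ((1ℚ - a) * (1ℚ - a * b * b)) * (ι * ι)
                           ≡ c′ * a * ((1ℚ - b) * ι * ((1ℚ - b) * ι * 1ℚ))
      collect = solve-∀ ℚ-ring

  C-shift : ∀ i j → C (suc (i ℕ.+ j)) j * [ suc i ] ≡ C (suc (i ℕ.+ j)) (suc j) * [ suc (suc (i ℕ.+ j) ℕ.+ j) ]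
  C-shift i j = trans (sym (ℚₚ.*-assoc (C N j) _ ι)) (trans (cong (_* ι) shift) (ℚₚ.*-assoc (C N (suc j)) _ ι))
    where
    N = suc (i ℕ.+ j)
    ι = inv (1ℚ - q)
    closed : C N (suc j) * (P i * P (N ℕ.+ suc j)) ≡ P N * P N
    closed = subst (λ m → C m (suc j) * (P i * P (m ℕ.+ suc j)) ≡ P m * P m) (ℕₚ.+-suc i j) (C-closed i (suc j))
    shuffle : ∀ c x A B → c * x * (A * B) ≡ c * ((A * x) * B)
    shuffle = solve-∀ ℚ-ring
    shuffle′ : ∀ c x A B → c * (A * (B * x)) ≡ c * x * (A * B)
    shuffle′ = solve-∀ ℚ-ring
    shift : C N j * (1ℚ - q ^ suc i) ≡ C N (suc j) * (1ℚ - q ^ suc (N ℕ.+ j))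
    shift = *-cancelʳ (P i * P (N ℕ.+ j)) (*-≢0 (P-≢0 i) (P-≢0 (N ℕ.+ j))) (begin
      C N j * (1ℚ - q ^ suc i) * (P i * P (N ℕ.+ j))
        ≡⟨ shuffle (C N j) _ (P i) (P (N ℕ.+ j)) ⟩
      C N j * ((P i * (1ℚ - q ^ suc i)) * P (N ℕ.+ j))
        ≡⟨ cong (λ z → C N j * (z * P (N ℕ.+ j))) (sym (P-suc i)) ⟩
      C N j * (P (suc i) * P (N ℕ.+ j))
        ≡⟨ C-closed (suc i) j ⟩
      P N * P N
        ≡⟨ sym closed ⟩
      C N (suc j) * (P i * P (N ℕ.+ suc j))
        ≡⟨ cong (λ m → C N (suc j) * (P i * m)) (trans (cong P (ℕₚ.+-suc N j)) (P-suc (N ℕ.+ j))) ⟩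
      C N (suc j) * (P i * (P (N ℕ.+ j) * (1ℚ - q ^ suc (N ℕ.+ j))))
        ≡⟨ shuffle′ (C N (suc j)) _ (P i) (P (N ℕ.+ j)) ⟩
      C N (suc j) * (1ℚ - q ^ suc (N ℕ.+ j)) * (P i * P (N ℕ.+ j)) ∎)
      where open ≡-Reasoning

  weight : ℕ → ℕ → ℚ
  weight a k = q ^ k * inv ([ k ] ^ a)

  ΔC : ℕ → ℕ → ℚ
  ΔC n k = C (suc n) k - C n k

  ΔC-solved : ∀ i j → ΔC (i ℕ.+ j) (suc j) ≡ C (suc (i ℕ.+ j)) (suc j) * q ^ i * [ suc j ] ^ 2 * inv ([ suc (i ℕ.+ j) ] ^ 2)
  ΔC-solved i j = solve-for (^-≢0 2 ([suc]≢0 (i ℕ.+ j))) (C-difference i j)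

  ∑-C-suc : ∀ n (f : ℕ → ℚ) → ∑ (suc n) (λ k → C (suc n) k * f k) ≡ ∑ n (λ k → C n k * f k) + ∑ (suc n) (λ k → ΔC n k * f k)
  ∑-C-suc n f = begin
    ∑ N (λ k → C N k * f k)
      ≡⟨ ∑-cong N (λ k _ → split (C N (suc k)) (C n (suc k)) (f (suc k))) ⟩
    ∑ N (λ k → C n k * f k + ΔC n k * f k)
      ≡⟨ ∑-+ N (λ k → C n k * f k) (λ k → ΔC n k * f k) ⟩
    ∑ n (λ k → C n k * f k) + C n N * f N + ∑ N (λ k → ΔC n k * f k)
      ≡⟨ cong (λ c → ∑ n (λ k → C n k * f k) + c * f N + ∑ N (λ k → ΔC n k * f k)) (C-suc-self n) ⟩
    ∑ n (λ k → C n k * f k) + 0ℚ * f N + ∑ N (λ k → ΔC n k * f k)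
      ≡⟨ drop (∑ n (λ k → C n k * f k)) (f N) _ ⟩
    ∑ n (λ k → C n k * f k) + ∑ N (λ k → ΔC n k * f k) ∎
    where
    open ≡-Reasoning
    N = suc n
    split : ∀ c′ c x → c′ * x ≡ c * x + (c′ - c) * x
    split = solve-∀ ℚ-ring
    drop : ∀ s x t → s + 0ℚ * x + t ≡ s + t
    drop = solve-∀ ℚ-ring

  ΔC-weight₂ : ∀ i j → ΔC (i ℕ.+ j) (suc j) * weight 2 (suc j) ≡ weight 2 (suc (i ℕ.+ j)) * C (suc (i ℕ.+ j)) (suc j)
  ΔC-weight₂ i j = begin
    ΔC (i ℕ.+ j) (suc j) * (b * inv Q²)
      ≡⟨ cong (_* (b * inv Q²)) (ΔC-solved i j) ⟩
    Cs * a * Q² * inv M² * (b * inv Q²)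
      ≡⟨ regroup Cs a Q² (inv M²) b (inv Q²) ⟩
    a * b * inv M² * Cs * (Q² * inv Q²)
      ≡⟨ cong₂ (λ x y → x * inv M² * Cs * y) (sym (q^-split i j)) (*-invʳ Q² (^-≢0 2 ([suc]≢0 j))) ⟩
    q ^ suc (i ℕ.+ j) * inv M² * Cs * 1ℚ
      ≡⟨ ℚₚ.*-identityʳ _ ⟩
    weight 2 (suc (i ℕ.+ j)) * Cs ∎
    where
    open ≡-Reasoning
    a = q ^ i
    b = q ^ suc j
    Q² = [ suc j ] ^ 2
    M² = [ suc (i ℕ.+ j) ] ^ 2
    Cs = C (suc (i ℕ.+ j)) (suc j)
    regroup : ∀ c a x y b z → c * a * x * y * (b * z) ≡ a * b * y * c * (x * z)
    regroup = solve-∀ ℚ-ring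

  ∑-weight₂ : ∀ (w : ℕ → ℚ) n →
    ∑ n (λ j → weight 2 j * ∑ j (λ k → C j k * w k)) ≡ ∑ n (λ k → C n k * (weight 2 k * w k))
  ∑-weight₂ w zero    = refl
  ∑-weight₂ w (suc n) = begin
    ∑ n (λ j → weight 2 j * ∑ j (λ k → C j k * w k)) + weight 2 N * ∑ N (λ k → C N k * w k)
      ≡⟨ cong₂ _+_ (∑-weight₂ w n) (sym (∑-*ˡ N (weight 2 N) _)) ⟩
    ∑ n (λ k → C n k * (weight 2 k * w k)) + ∑ N (λ k → weight 2 N * (C N k * w k))
      ≡⟨ cong (_+_ (∑ n (λ k → C n k * (weight 2 k * w k)))) (∑-cong N (λ j j<N → pointwise j (ℕₚ.≤-pred j<N))) ⟩
    ∑ n (λ k → C n k * (weight 2 k * w k)) + ∑ N (λ k → ΔC n k * (weight 2 k * w k))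
      ≡⟨ sym (∑-C-suc n (λ k → weight 2 k * w k)) ⟩
    ∑ N (λ k → C N k * (weight 2 k * w k)) ∎
    where
    open ≡-Reasoning
    N = suc n
    pointwise : ∀ j → j ≤ n → weight 2 N * (C N (suc j) * w (suc j)) ≡ ΔC n (suc j) * (weight 2 (suc j) * w (suc j))
    pointwise j j≤n = begin
      weight 2 N * (C N (suc j) * w (suc j))        ≡⟨ sym (ℚₚ.*-assoc (weight 2 N) (C N (suc j)) (w (suc j))) ⟩
      weight 2 N * C N (suc j) * w (suc j)          ≡⟨ cong (_* w (suc j)) (sym (by-offset R ΔC-weight₂ n j j≤n)) ⟩
      ΔC n (suc j) * weight 2 (suc j) * w (suc j)   ≡⟨ ℚₚ.*-assoc (ΔC n (suc j)) (weight 2 (suc j)) (w (suc j)) ⟩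
      ΔC n (suc j) * (weight 2 (suc j) * w (suc j)) ∎
      where
      R : ℕ → ℕ → Set
      R n j = ΔC n (suc j) * weight 2 (suc j) ≡ weight 2 (suc n) * C (suc n) (suc j)

  q^square-suc : ∀ j → q ^ (suc j ℕ.* suc j) ≡ q ^ (j ℕ.* j) * q ^ j * q ^ suc j
  q^square-suc j = begin
    q ^ (suc j ℕ.* suc j)                  ≡⟨ cong (q ^_) (expand j) ⟩
    q ^ (j ℕ.* j ℕ.+ j ℕ.+ suc j)          ≡⟨ ^-+ q (j ℕ.* j ℕ.+ j) (suc j) ⟩
    q ^ (j ℕ.* j ℕ.+ j) * q ^ suc j        ≡⟨ cong (_* q ^ suc j) (^-+ q (j ℕ.* j) j) ⟩
    q ^ (j ℕ.* j) * q ^ j * q ^ suc j      ∎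
    where
    open ≡-Reasoning
    expand : ∀ j → suc j ℕ.* suc j ≡ j ℕ.* j ℕ.+ j ℕ.+ suc j
    expand = ℕ-ring.solve-∀

  commaFactor : ℕ → ℚ
  commaFactor k = (1ℚ + q ^ k) * inv [ k ] * q ^ (k ℕ.* k)

  -- V n j = ∑_{j < k ≤ n + 1} ΔC n k * commaFactor k, in closed form.
  V : ℕ → ℕ → ℚ
  V n j = weight 2 (suc n) * C (suc n) j * q ^ (j ℕ.* j) * q ^ j * [ suc n ℕ.∸ j ]

  V-last : ∀ n → V n (suc n) ≡ 0ℚ
  V-last n = trans (cong (λ m → X * [ m ]) (ℕₚ.n∸n≡0 n)) (vanish X (inv (1ℚ - q)))
    where
    X = weight 2 (suc n) * C (suc n) (suc n) * q ^ (suc n ℕ.* suc n) * q ^ suc n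
    vanish : ∀ x ι → x * ((1ℚ - 1ℚ) * ι) ≡ 0ℚ
    vanish = solve-∀ ℚ-ring

  V-step : ∀ i j → V (i ℕ.+ j) j ≡ V (i ℕ.+ j) (suc j) + ΔC (i ℕ.+ j) (suc j) * commaFactor (suc j)
  V-step i j = sym (begin
    V n (suc j) + ΔC n (suc j) * commaFactor (suc j)
      ≡⟨ cong₂ _+_ V-suc-unfold (cong₂ (λ d x → d * ((1ℚ + b) * inv Q * x)) (ΔC-solved i j) (q^square-suc j)) ⟩
    a * b * iM * Cs * (u * b) * b * [ i ] + Cs * a * (Q * (Q * 1ℚ)) * iM * ((1ℚ + b) * inv Q * (u * b))
      ≡⟨ regroup₁ a b iM Cs u [ i ] Q (inv Q) ⟩
    a * b * iM * u * (Cs * (b * b * [ i ] + (1ℚ + b) * Q * (Q * inv Q)))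
      ≡⟨ cong (λ z → a * b * iM * u * (Cs * (b * b * [ i ] + (1ℚ + b) * Q * z))) (*-invʳ Q ([suc]≢0 j)) ⟩
    a * b * iM * u * (Cs * (b * b * [ i ] + (1ℚ + b) * Q * 1ℚ))
      ≡⟨ cong (a * b * iM * u *_) (cong (Cs *_) (regroup₂ b [ i ] Q)) ⟩
    a * b * iM * u * (Cs * (Q + b * (Q + b * [ i ])))
      ≡⟨ cong (λ z → a * b * iM * u * (Cs * z)) (sym (trans ([]-split₂ i j) (cong (λ z → Q + b * z) ([]-split i j)))) ⟩
    a * b * iM * u * (Cs * [ suc (N ℕ.+ j) ])
      ≡⟨ cong (a * b * iM * u *_) (sym (C-shift i j)) ⟩
    a * b * iM * u * (C N j * [ suc i ])
      ≡⟨ regroup₃ a b iM (q ^ (j ℕ.* j)) (q ^ j) (C N j) [ suc i ] ⟩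
    a * b * iM * C N j * q ^ (j ℕ.* j) * q ^ j * [ suc i ]
      ≡⟨ sym V-unfold ⟩
    V n j ∎)
    where
    open ≡-Reasoning
    n = i ℕ.+ j
    N = suc n
    a = q ^ i
    b = q ^ suc j
    u = q ^ (j ℕ.* j) * q ^ j
    Q = [ suc j ]
    iM = inv ([ N ] ^ 2)
    Cs = C N (suc j)
    V-unfold : V n j ≡ a * b * iM * C N j * q ^ (j ℕ.* j) * q ^ j * [ suc i ]
    V-unfold = cong₂ (λ x m → x * iM * C N j * q ^ (j ℕ.* j) * q ^ j * [ m ]) (q^-split i j) (ℕₚ.m+n∸n≡m (suc i) j)
    V-suc-unfold : V n (suc j) ≡ a * b * iM * Cs * (u * b) * b * [ i ]
    V-suc-unfold = trans (cong₂ (λ x y → x * iM * Cs * y * b * [ N ℕ.∸ suc j ]) (q^-split i j) (q^square-suc j))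
                         (cong (λ m → a * b * iM * Cs * (u * b) * b * [ m ]) (ℕₚ.m+n∸n≡m i j))
    regroup₁ : ∀ a b iM Cs u x Q iQ →
      a * b * iM * Cs * (u * b) * b * x + Cs * a * (Q * (Q * 1ℚ)) * iM * ((1ℚ + b) * iQ * (u * b))
        ≡ a * b * iM * u * (Cs * (b * b * x + (1ℚ + b) * Q * (Q * iQ)))
    regroup₁ = solve-∀ ℚ-ring
    regroup₂ : ∀ b x Q → b * b * x + (1ℚ + b) * Q * 1ℚ ≡ Q + b * (Q + b * x)
    regroup₂ = solve-∀ ℚ-ring
    regroup₃ : ∀ a b iM s t c x → a * b * iM * (s * t) * (c * x) ≡ a * b * iM * c * s * t * x
    regroup₃ = solve-∀ ℚ-ring

  ΔC-weight₁ : ∀ i j → inv (q ^ (suc j ℕ.* suc j)) * V (i ℕ.+ j) (suc j) + ΔC (i ℕ.+ j) (suc j) * weight 1 (suc j)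
                     ≡ weight 1 (suc (i ℕ.+ j)) * C (suc (i ℕ.+ j)) (suc j)
  ΔC-weight₁ i j = begin
    inv A * V n (suc j) + ΔC n (suc j) * (b * inv Q¹)
      ≡⟨ cong₂ (λ v d → inv A * v + d * (b * inv Q¹)) V-unfold (ΔC-solved i j) ⟩
    inv A * (a * b * iM * Cs * A * b * [ i ]) + Cs * a * (Q * Q¹) * iM * (b * inv Q¹)
      ≡⟨ regroup₁ a b iM Cs A (inv A) [ i ] Q Q¹ (inv Q¹) ⟩
    a * b * Cs * (iM * (b * [ i ] * (inv A * A) + Q * (Q¹ * inv Q¹)))
      ≡⟨ cong₂ (λ x y → a * b * Cs * (iM * (b * [ i ] * x + Q * y))) (*-invˡ A (^-≢0 (suc j ℕ.* suc j) q≢0)) (*-invʳ Q¹ (^-≢0 1 ([suc]≢0 j))) ⟩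
    a * b * Cs * (iM * (b * [ i ] * 1ℚ + Q * 1ℚ))
      ≡⟨ cong (λ z → a * b * Cs * (iM * z)) (trans (regroup₂ b [ i ] Q) (sym ([]-split i j))) ⟩
    a * b * Cs * (iM * [ N ])
      ≡⟨ cong (a * b * Cs *_) (inv-*-cancelˡ ([ N ] * 1ℚ) ([suc]≢0 n)) ⟩
    a * b * Cs * inv ([ N ] ^ 1)
      ≡⟨ regroup₃ (a * b) Cs (inv ([ N ] ^ 1)) ⟩
    a * b * inv ([ N ] ^ 1) * Cs
      ≡⟨ cong (λ x → x * inv ([ N ] ^ 1) * Cs) (sym (q^-split i j)) ⟩
    weight 1 N * Cs ∎
    where
    open ≡-Reasoning
    n = i ℕ.+ j
    N = suc n
    a = q ^ i
    b = q ^ suc j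
    A = q ^ (suc j ℕ.* suc j)
    Q = [ suc j ]
    Q¹ = [ suc j ] ^ 1
    iM = inv ([ N ] ^ 2)
    Cs = C N (suc j)
    V-unfold : V n (suc j) ≡ a * b * iM * Cs * A * b * [ i ]
    V-unfold = cong₂ (λ x m → x * iM * Cs * A * b * [ m ]) (q^-split i j) (ℕₚ.m+n∸n≡m i j)
    regroup₁ : ∀ a b iM Cs A iA x Q Q¹ iQ¹ →
      iA * (a * b * iM * Cs * A * b * x) + Cs * a * (Q * Q¹) * iM * (b * iQ¹)
        ≡ a * b * Cs * (iM * (b * x * (iA * A) + Q * (Q¹ * iQ¹)))
    regroup₁ = solve-∀ ℚ-ring
    regroup₂ : ∀ b x Q → b * x * 1ℚ + Q * 1ℚ ≡ Q + b * x
    regroup₂ = solve-∀ ℚ-ring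
    regroup₃ : ∀ x y z → x * y * z ≡ x * z * y
    regroup₃ = solve-∀ ℚ-ring

  ∑-weight₁ : ∀ (w : ℕ → ℚ) n →
    ∑ n (λ j → weight 1 j * ∑ j (λ k → C j k * w k))
      ≡ ∑ n (λ k → C n k * (commaFactor k * ∑ (ℕ.pred k) (λ j → inv (q ^ (j ℕ.* j)) * w j) + weight 1 k * w k))
  ∑-weight₁ w zero    = refl
  ∑-weight₁ w (suc n) = begin
    ∑ n (λ j → weight 1 j * ∑ j (λ k → C j k * w k)) + weight 1 N * ∑ N (λ k → C N k * w k)
      ≡⟨ cong₂ _+_ (∑-weight₁ w n) (sym (∑-*ˡ N (weight 1 N) _)) ⟩
    ∑ n (λ k → C n k * F k) + ∑ N (λ k → weight 1 N * (C N k * w k))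
      ≡⟨ cong (_+_ (∑ n (λ k → C n k * F k))) (sym new-terms) ⟩
    ∑ n (λ k → C n k * F k) + ∑ N (λ k → ΔC n k * F k)
      ≡⟨ sym (∑-C-suc n F) ⟩
    ∑ N (λ k → C N k * F k) ∎
    where
    open ≡-Reasoning
    N = suc n
    u : ℕ → ℚ
    u j = inv (q ^ (j ℕ.* j)) * w j
    F : ℕ → ℚ
    F k = commaFactor k * ∑ (ℕ.pred k) u + weight 1 k * w k
    distribute : ∀ d c s x → d * (c * s + x) ≡ d * c * s + d * x
    distribute = solve-∀ ℚ-ring
    factor : ∀ iA v d t x → iA * x * v + d * (t * x) ≡ (iA * v + d * t) * x
    factor = solve-∀ ℚ-ring
    pointwise : ∀ j → j ≤ n → u (suc j) * V n (suc j) + ΔC n (suc j) * (weight 1 (suc j) * w (suc j))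
                            ≡ weight 1 N * (C N (suc j) * w (suc j))
    pointwise j j≤n = begin
      u (suc j) * V n (suc j) + ΔC n (suc j) * (weight 1 (suc j) * w (suc j))
        ≡⟨ factor (inv (q ^ (suc j ℕ.* suc j))) (V n (suc j)) (ΔC n (suc j)) (weight 1 (suc j)) (w (suc j)) ⟩
      (inv (q ^ (suc j ℕ.* suc j)) * V n (suc j) + ΔC n (suc j) * weight 1 (suc j)) * w (suc j)
        ≡⟨ cong (_* w (suc j)) (by-offset R ΔC-weight₁ n j j≤n) ⟩
      weight 1 N * C N (suc j) * w (suc j)
        ≡⟨ ℚₚ.*-assoc (weight 1 N) (C N (suc j)) (w (suc j)) ⟩
      weight 1 N * (C N (suc j) * w (suc j)) ∎
      where
      R : ℕ → ℕ → Set
      R n j = inv (q ^ (suc j ℕ.* suc j)) * V n (suc j) + ΔC n (suc j) * weight 1 (suc j) ≡ weight 1 (suc n) * C (suc n) (suc j)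
    new-terms : ∑ N (λ k → ΔC n k * F k) ≡ ∑ N (λ k → weight 1 N * (C N k * w k))
    new-terms = begin
      ∑ N (λ k → ΔC n k * F k)
        ≡⟨ ∑-cong N (λ k _ → distribute (ΔC n (suc k)) (commaFactor (suc k)) (∑ k u) (weight 1 (suc k) * w (suc k))) ⟩
      ∑ N (λ k → ΔC n k * commaFactor k * ∑ (ℕ.pred k) u + ΔC n k * (weight 1 k * w k))
        ≡⟨ ∑-+ N _ _ ⟩
      ∑ N (λ k → ΔC n k * commaFactor k * ∑ (ℕ.pred k) u) + ∑ N (λ k → ΔC n k * (weight 1 k * w k))
        ≡⟨ cong (_+ ∑ N (λ k → ΔC n k * (weight 1 k * w k)))
                (∑-by-parts N (λ k → ΔC n k * commaFactor k) u (V n)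
                            (λ j j<N → by-offset (λ n j → V n j ≡ V n (suc j) + ΔC n (suc j) * commaFactor (suc j)) V-step n j (ℕₚ.≤-pred j<N))
                            (V-last n)) ⟩
      ∑ N (λ j → u j * V n j) + ∑ N (λ k → ΔC n k * (weight 1 k * w k))
        ≡⟨ sym (∑-+ N _ _) ⟩
      ∑ N (λ j → u j * V n j + ΔC n j * (weight 1 j * w j))
        ≡⟨ ∑-cong N (λ j j<N → pointwise j (ℕₚ.≤-pred j<N)) ⟩
      ∑ N (λ k → weight 1 N * (C N k * w k)) ∎

  alternating : ℕ → ℚ
  alternating k = sign q k * q ^ triangle k * (1ℚ + q ^ k)

  -- ∑_{k ≤ K} C (n + 1) k * alternating k = Φ n K - Φ n 0
  Φ : ℕ → ℕ → ℚ
  Φ n k = sign q k * C (suc n) k * q ^ triangle (suc k) * [ suc n ℕ.∸ k ] * inv [ suc n ]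

  Φ-step : ∀ i j → C (suc (i ℕ.+ j)) (suc j) * alternating (suc j) ≡ Φ (i ℕ.+ j) (suc j) - Φ (i ℕ.+ j) j
  Φ-step i j = begin
    Cs * (- s * T * (1ℚ + b))
      ≡⟨ cong (λ z → Cs * (- s * T * z)) (solve-for ([suc]≢0 n) 1+b-relation) ⟩
    Cs * (- s * T * ((b * [ i ] + [ M ]) * inv [ N ]))
      ≡⟨ regroup₁ Cs s T b [ i ] [ M ] (inv [ N ]) ⟩
    - s * Cs * (b * T) * [ i ] * inv [ N ] - s * (Cs * [ M ]) * T * inv [ N ]
      ≡⟨ cong (λ z → - s * Cs * (b * T) * [ i ] * inv [ N ] - s * z * T * inv [ N ]) (sym (C-shift i j)) ⟩
    - s * Cs * (b * T) * [ i ] * inv [ N ] - s * (C N j * [ suc i ]) * T * inv [ N ]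
      ≡⟨ cong (λ z → - s * Cs * (b * T) * [ i ] * inv [ N ] - z) (regroup₂ s (C N j) [ suc i ] T (inv [ N ])) ⟩
    - s * Cs * (b * T) * [ i ] * inv [ N ] - s * C N j * T * [ suc i ] * inv [ N ]
      ≡⟨ cong₂ _-_ Φ-suc-unfold Φ-unfold ⟩
    Φ n (suc j) - Φ n j ∎
    where
    open ≡-Reasoning
    n = i ℕ.+ j
    N = suc n
    M = suc (N ℕ.+ j)
    s = sign q j
    T = q ^ triangle (suc j)
    b = q ^ suc j
    Cs = C N (suc j)
    1+b-relation : (1ℚ + b) * [ N ] ≡ b * [ i ] + [ M ]
    1+b-relation = begin
      (1ℚ + b) * [ N ]               ≡⟨ distrib b [ N ] ⟩
      [ N ] + b * [ N ]              ≡⟨ cong (_+ b * [ N ]) ([]-split i j) ⟩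
      [ suc j ] + b * [ i ] + b * [ N ] ≡⟨ swap [ suc j ] (b * [ i ]) (b * [ N ]) ⟩
      b * [ i ] + ([ suc j ] + b * [ N ]) ≡⟨ cong (_+_ (b * [ i ])) (sym ([]-split₂ i j)) ⟩
      b * [ i ] + [ M ]              ∎
      where
      distrib : ∀ b x → (1ℚ + b) * x ≡ x + b * x
      distrib = solve-∀ ℚ-ring
      swap : ∀ x y z → x + y + z ≡ y + (x + z)
      swap = solve-∀ ℚ-ring
    Φ-suc-unfold : - s * Cs * (b * T) * [ i ] * inv [ N ] ≡ Φ n (suc j)
    Φ-suc-unfold = sym (cong₂ (λ x m → - s * Cs * x * [ m ] * inv [ N ]) (^-+ q (suc j) (triangle (suc j))) (ℕₚ.m+n∸n≡m i j))
    Φ-unfold : s * C N j * T * [ suc i ] * inv [ N ] ≡ Φ n j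
    Φ-unfold = sym (cong (λ m → s * C N j * T * [ m ] * inv [ N ]) (ℕₚ.m+n∸n≡m (suc i) j))
    regroup₁ : ∀ c s T b x y iN → c * (- s * T * ((b * x + y) * iN)) ≡ - s * c * (b * T) * x * iN - s * (c * y) * T * iN
    regroup₁ = solve-∀ ℚ-ring
    regroup₂ : ∀ s c x T iN → s * (c * x) * T * iN ≡ s * c * T * x * iN
    regroup₂ = solve-∀ ℚ-ring

  ∑-C-alternating : ∀ n → ∑ (suc n) (λ k → C (suc n) k * alternating k) ≡ - 1ℚ
  ∑-C-alternating n = begin
    ∑ N (λ k → C N k * alternating k)
      ≡⟨ ∑-cong N (λ j j<N → by-offset R Φ-step n j (ℕₚ.≤-pred j<N)) ⟩
    ∑ N (λ k → Φ n k - Φ n (ℕ.pred k))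
      ≡⟨ ∑-telescope N (Φ n) ⟩
    Φ n N - Φ n 0
      ≡⟨ cong₂ _-_ Φ-last Φ-first ⟩
    0ℚ - 1ℚ ∎
    where
    open ≡-Reasoning
    N = suc n
    R : ℕ → ℕ → Set
    R n j = C (suc n) (suc j) * alternating (suc j) ≡ Φ n (suc j) - Φ n j
    Φ-last : Φ n N ≡ 0ℚ
    Φ-last = trans (cong (λ m → sign q N * C N N * q ^ triangle (suc N) * [ m ] * inv [ N ]) (ℕₚ.n∸n≡0 n))
                   (vanish (sign q N * C N N * q ^ triangle (suc N)) (inv (1ℚ - q)) (inv [ N ]))
      where
      vanish : ∀ x ι y → x * ((1ℚ - 1ℚ) * ι) * y ≡ 0ℚ
      vanish = solve-∀ ℚ-ring
    Φ-first : Φ n 0 ≡ 1ℚ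
    Φ-first = begin
      1ℚ * C N 0 * 1ℚ * [ N ] * inv [ N ]     ≡⟨ cong (λ c → 1ℚ * c * 1ℚ * [ N ] * inv [ N ]) (C-zero N) ⟩
      1ℚ * 1ℚ * 1ℚ * [ N ] * inv [ N ]        ≡⟨ units [ N ] (inv [ N ]) ⟩
      [ N ] * inv [ N ]                       ≡⟨ *-invʳ [ N ] ([suc]≢0 n) ⟩
      1ℚ                                      ∎
      where
      units : ∀ x y → 1ℚ * 1ℚ * 1ℚ * x * y ≡ x * y
      units = solve-∀ ℚ-ring

  W : (m : ℕ) → Vec ℤ (suc m) → Vec ℤ (suc m) → ℕ → ℚ
  W m s t k = sumℚ (map (λ ks → sign q (Vec.last (k ∷ ks)) * q ^ (k ℕ.* k ℕ.∸ triangle (Vec.last (k ∷ ks))) * factors q (k ∷ ks) s t)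
                        (decSeqs q m (k ℕ.∸ 1)))

  Hbar-by-first : ∀ n m s t → Hbar q n (suc m) s t ≡ ∑ n (λ k → C n k * W m s t k)
  Hbar-by-first n m s t = begin
    sumℚ (map term (concatMap (λ k → map (k ∷_) (decSeqs q m (k ℕ.∸ 1))) (range1 n)))
      ≡⟨ sumℚ-concatMap term _ (range1 n) ⟩
    sumℚ (map (λ k → sumℚ (map term (map (k ∷_) (decSeqs q m (k ℕ.∸ 1))))) (range1 n))
      ≡⟨ sumℚ-range1 n _ ⟩
    ∑ n (λ k → sumℚ (map term (map (k ∷_) (decSeqs q m (k ℕ.∸ 1)))))
      ≡⟨ ∑-cong n (λ k _ → sumℚ-map-prepend term _ (C n (suc k)) (suc k) (decSeqs q m k) (split (suc k))) ⟩
    ∑ n (λ k → C n k * W m s t k) ∎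
    where
    open ≡-Reasoning
    term : Vec ℕ (suc m) → ℚ
    term ks = sign q (Vec.last ks) * qbinom q n (Vec.head ks) * inv (qbinom q (n ℕ.+ Vec.head ks) (Vec.head ks))
            * q ^ (Vec.head ks ℕ.* Vec.head ks ℕ.∸ (Vec.last ks ℕ.* (Vec.last ks ℕ.∸ 1)) ℕ./ 2) * factors q ks s t
    regroup : ∀ σ b ib e f → σ * b * ib * e * f ≡ b * ib * (σ * e * f)
    regroup = solve-∀ ℚ-ring
    split : ∀ k ks → term (k ∷ ks) ≡ C n k * (sign q (Vec.last (k ∷ ks)) * q ^ (k ℕ.* k ℕ.∸ triangle (Vec.last (k ∷ ks))) * factors q (k ∷ ks) s t)
    split k ks = trans (cong (λ e → sign q v * qbinom q n k * inv (qbinom q (n ℕ.+ k) k) * q ^ (k ℕ.* k ℕ.∸ e) * factors q (k ∷ ks) s t)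
                             (half-k[k-1]≡triangle v))
                       (regroup (sign q v) _ _ _ _)
      where v = Vec.last (k ∷ ks)

  q^ℤ[t-1]k : ∀ t k → q ^ℤ ((+ t ℤ.- + 1) ℤ.* + k) ≡ q ^ (t ℕ.* k) * inv (q ^ k)
  q^ℤ[t-1]k zero    zero    = refl
  q^ℤ[t-1]k zero    (suc k) = trans (cong (q ^ℤ_) (ℤₚ.-1*i≡-i (+ suc k))) (sym (ℚₚ.*-identityˡ _))
  q^ℤ[t-1]k (suc t) k = begin
    q ^ℤ (+ t ℤ.* + k)                       ≡⟨ cong (q ^ℤ_) (sym (ℤₚ.pos-* t k)) ⟩
    q ^ (t ℕ.* k)                            ≡⟨ sym (ℚₚ.*-identityʳ _) ⟩
    q ^ (t ℕ.* k) * 1ℚ                       ≡⟨ cong (q ^ (t ℕ.* k) *_) (sym (*-invʳ (q ^ k) (^-≢0 k q≢0))) ⟩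
    q ^ (t ℕ.* k) * (q ^ k * inv (q ^ k))    ≡⟨ regroup (q ^ (t ℕ.* k)) (q ^ k) (inv (q ^ k)) ⟩
    q ^ k * q ^ (t ℕ.* k) * inv (q ^ k)      ≡⟨ cong (_* inv (q ^ k)) (sym (^-+ q k (t ℕ.* k))) ⟩
    q ^ (suc t ℕ.* k) * inv (q ^ k)          ∎
    where
    open ≡-Reasoning
    regroup : ∀ x y z → x * (y * z) ≡ y * x * z
    regroup = solve-∀ ℚ-ring

  blockFactor : ℕ → ℕ → ℕ → ℚ
  blockFactor k p t = (1ℚ + q ^ k) * q ^ℤ ((+ t ℤ.- + 1) ℤ.* + k) * inv ([ k ] ^ p)

  blockFactor-plus : ∀ k a p t → blockFactor k (a ℕ.+ p) (1 ℕ.+ t) ≡ weight a k * blockFactor k p t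
  blockFactor-plus k a p t = begin
    (1ℚ + q ^ k) * q ^ℤ ((+ suc t ℤ.- + 1) ℤ.* + k) * inv ([ k ] ^ (a ℕ.+ p))
      ≡⟨ cong₂ (λ x y → (1ℚ + q ^ k) * x * y) (q^ℤ[t-1]k (suc t) k) (trans (cong inv (^-+ [ k ] a p)) (inv-* ([ k ] ^ a) ([ k ] ^ p))) ⟩
    (1ℚ + q ^ k) * (q ^ (k ℕ.+ t ℕ.* k) * inv (q ^ k)) * (inv ([ k ] ^ a) * inv ([ k ] ^ p))
      ≡⟨ cong (λ x → (1ℚ + q ^ k) * (x * inv (q ^ k)) * (inv ([ k ] ^ a) * inv ([ k ] ^ p))) (^-+ q k (t ℕ.* k)) ⟩
    (1ℚ + q ^ k) * (q ^ k * q ^ (t ℕ.* k) * inv (q ^ k)) * (inv ([ k ] ^ a) * inv ([ k ] ^ p))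
      ≡⟨ regroup (1ℚ + q ^ k) (q ^ k) (q ^ (t ℕ.* k)) (inv (q ^ k)) (inv ([ k ] ^ a)) (inv ([ k ] ^ p)) ⟩
    weight a k * ((1ℚ + q ^ k) * (q ^ (t ℕ.* k) * inv (q ^ k)) * inv ([ k ] ^ p))
      ≡⟨ cong (λ x → weight a k * ((1ℚ + q ^ k) * x * inv ([ k ] ^ p))) (sym (q^ℤ[t-1]k t k)) ⟩
    weight a k * blockFactor k p t ∎
    where
    open ≡-Reasoning
    regroup : ∀ e b c ib ia ip → e * (b * c * ib) * (ia * ip) ≡ b * ia * (e * (c * ib) * ip)
    regroup = solve-∀ ℚ-ring

  blockFactor-comma : ∀ k → blockFactor k 1 1 ≡ (1ℚ + q ^ k) * inv [ k ]
  blockFactor-comma k = trans (cong (λ y → (1ℚ + q ^ k) * 1ℚ * inv y) (ℚₚ.*-identityʳ [ k ]))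
                              (cong (_* inv [ k ]) (ℚₚ.*-identityʳ (1ℚ + q ^ k)))

  W-plus : ∀ m a p t (ss ts : Vec ℤ m) k →
    W m (+ (a ℕ.+ p) ∷ ss) (+ (1 ℕ.+ t) ∷ ts) k ≡ weight a k * W m (+ p ∷ ss) (+ t ∷ ts) k
  W-plus m a p t ss ts k = trans (sumℚ-map-cong (decSeqs q m (k ℕ.∸ 1)) per-sequence) (sumℚ-map-*ˡ (weight a k) (term p t) (decSeqs q m (k ℕ.∸ 1)))
    where
    term : ℕ → ℕ → Vec ℕ m → ℚ
    term p t ks = sign q (Vec.last (k ∷ ks)) * q ^ (k ℕ.* k ℕ.∸ triangle (Vec.last (k ∷ ks))) * factors q (k ∷ ks) (+ p ∷ ss) (+ t ∷ ts)
    regroup : ∀ σ e w f r → σ * e * (w * f * r) ≡ w * (σ * e * (f * r))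
    regroup = solve-∀ ℚ-ring
    per-sequence : ∀ ks → term (a ℕ.+ p) (1 ℕ.+ t) ks ≡ weight a k * term p t ks
    per-sequence ks = trans (cong (λ f → σ * e * (f * factors q ks ss ts)) (blockFactor-plus k a p t))
                            (regroup σ e (weight a k) (blockFactor k p t) (factors q ks ss ts))
      where
      σ = sign q (Vec.last (k ∷ ks))
      e = q ^ (k ℕ.* k ℕ.∸ triangle (Vec.last (k ∷ ks)))

  decSeqs-bounded : ∀ m b → ListAll.All (All (_≤ b)) (decSeqs q m b)
  decSeqs-bounded zero    b = [] ListAll.∷ ListAll.[]
  decSeqs-bounded (suc m) b =
    ListAllₚ.concat⁺ (ListAllₚ.map⁺ (ListAll.map prepend-bounded (range1-bounded b)))
    where
    prepend-bounded : ∀ {k} → k ≤ b → ListAll.All (All (_≤ b)) (map (k ∷_) (decSeqs q m (k ℕ.∸ 1)))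
    prepend-bounded {k} k≤b =
      ListAllₚ.map⁺ (ListAll.map (λ ks≤ → k≤b ∷ All.map (λ x≤ → ℕₚ.≤-trans x≤ (ℕₚ.≤-trans (ℕₚ.m∸n≤m k 1) k≤b)) ks≤)
                                 (decSeqs-bounded m (k ℕ.∸ 1)))

  W-comma : ∀ m p t (ss ts : Vec ℤ m) k →
    W (suc m) (+ 1 ∷ + p ∷ ss) (+ 1 ∷ + t ∷ ts) (suc k)
      ≡ commaFactor (suc k) * ∑ k (λ j → inv (q ^ (j ℕ.* j)) * W m (+ p ∷ ss) (+ t ∷ ts) j)
  W-comma m p t ss ts k = begin
    sumℚ (map G (concatMap (λ j → map (j ∷_) (decSeqs q m (j ℕ.∸ 1))) (range1 k)))
      ≡⟨ sumℚ-concatMap G _ (range1 k) ⟩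
    sumℚ (map (λ j → sumℚ (map G (map (j ∷_) (decSeqs q m (j ℕ.∸ 1))))) (range1 k))
      ≡⟨ sumℚ-range1 k _ ⟩
    ∑ k (λ j → sumℚ (map G (map (j ∷_) (decSeqs q m (j ℕ.∸ 1)))))
      ≡⟨ ∑-cong k (λ j j<k → first-index j (ℕₚ.<⇒≤ j<k)) ⟩
    ∑ k (λ j → commaFactor (suc k) * (inv (q ^ (j ℕ.* j)) * W m (+ p ∷ ss) (+ t ∷ ts) j))
      ≡⟨ ∑-*ˡ k (commaFactor (suc k)) _ ⟩
    commaFactor (suc k) * ∑ k (λ j → inv (q ^ (j ℕ.* j)) * W m (+ p ∷ ss) (+ t ∷ ts) j) ∎
    where
    open ≡-Reasoning
    K = suc k ℕ.* suc k
    R : ℕ → Vec ℕ m → ℚ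
    R j ks = factors q (j ∷ ks) (+ p ∷ ss) (+ t ∷ ts)
    G : Vec ℕ (suc m) → ℚ
    G ks = sign q (Vec.last (suc k ∷ ks)) * q ^ (K ℕ.∸ triangle (Vec.last (suc k ∷ ks))) * (blockFactor (suc k) 1 1 * factors q ks (+ p ∷ ss) (+ t ∷ ts))
    g : ℕ → Vec ℕ m → ℚ
    g j ks = sign q (Vec.last (j ∷ ks)) * q ^ (j ℕ.* j ℕ.∸ triangle (Vec.last (j ∷ ks))) * R j ks
    insert : ∀ σ K iL e r J iJ → iJ * J ≡ 1ℚ → σ * (K * iL) * (e * r) ≡ e * K * (iJ * (σ * (J * iL) * r))
    insert σ K iL e r J iJ iJ*J≡1 = trans (sym (ℚₚ.*-identityʳ _)) (trans (cong (σ * (K * iL) * (e * r) *_) (sym iJ*J≡1)) (regroup σ K iL e r J iJ))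
      where
      regroup : ∀ σ K iL e r J iJ → σ * (K * iL) * (e * r) * (iJ * J) ≡ e * K * (iJ * (σ * (J * iL) * r))
      regroup = solve-∀ ℚ-ring
    per-sequence : ∀ j → j ≤ k → ∀ {ks} → All (_≤ j) ks → G (suc j ∷ ks) ≡ commaFactor (suc k) * (inv (q ^ (suc j ℕ.* suc j)) * g (suc j) ks)
    per-sequence j j≤k {ks} ks≤j = begin
      σ * q ^ (K ℕ.∸ L) * (blockFactor (suc k) 1 1 * R (suc j) ks)
        ≡⟨ cong₂ (λ x y → σ * x * (y * R (suc j) ks)) (^-∸ q q≢0 (ℕₚ.≤-trans L≤J J≤K)) (blockFactor-comma (suc k)) ⟩
      σ * (q ^ K * inv (q ^ L)) * ((1ℚ + q ^ suc k) * inv [ suc k ] * R (suc j) ks)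
        ≡⟨ insert σ (q ^ K) (inv (q ^ L)) ((1ℚ + q ^ suc k) * inv [ suc k ]) (R (suc j) ks) (q ^ J) (inv (q ^ J)) (*-invˡ (q ^ J) (^-≢0 J q≢0)) ⟩
      commaFactor (suc k) * (inv (q ^ J) * (σ * (q ^ J * inv (q ^ L)) * R (suc j) ks))
        ≡⟨ cong (λ x → commaFactor (suc k) * (inv (q ^ J) * (σ * x * R (suc j) ks))) (sym (^-∸ q q≢0 L≤J)) ⟩
      commaFactor (suc k) * (inv (q ^ J) * g (suc j) ks) ∎
      where
      v = Vec.last (suc j ∷ ks)
      σ = sign q v
      L = triangle v
      J = suc j ℕ.* suc j
      v≤j+1 : v ≤ suc j
      v≤j+1 = last-≤ (suc j ∷ ks) (ℕₚ.≤-refl ∷ All.map ℕₚ.m≤n⇒m≤1+n ks≤j)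
      L≤J : L ≤ J
      L≤J = ℕₚ.≤-trans (triangle≤square v) (ℕₚ.*-mono-≤ v≤j+1 v≤j+1)
      J≤K : J ≤ K
      J≤K = ℕₚ.*-mono-≤ (ℕ.s≤s j≤k) (ℕ.s≤s j≤k)
    first-index : ∀ j → j ≤ k → sumℚ (map G (map (suc j ∷_) (decSeqs q m j)))
                              ≡ commaFactor (suc k) * (inv (q ^ (suc j ℕ.* suc j)) * W m (+ p ∷ ss) (+ t ∷ ts) (suc j))
    first-index j j≤k = begin
      sumℚ (map G (map (suc j ∷_) (decSeqs q m j)))
        ≡⟨ sumℚ-map-∘ G (suc j ∷_) (decSeqs q m j) ⟩
      sumℚ (map (λ ks → G (suc j ∷ ks)) (decSeqs q m j))
        ≡⟨ cong sumℚ (Listₚ.map-cong-local (ListAll.map (per-sequence j j≤k) (decSeqs-bounded m j))) ⟩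
      sumℚ (map (λ ks → commaFactor (suc k) * (inv (q ^ (suc j ℕ.* suc j)) * g (suc j) ks)) (decSeqs q m j))
        ≡⟨ sumℚ-map-*ˡ (commaFactor (suc k)) _ (decSeqs q m j) ⟩
      commaFactor (suc k) * sumℚ (map (λ ks → inv (q ^ (suc j ℕ.* suc j)) * g (suc j) ks) (decSeqs q m j))
        ≡⟨ cong (commaFactor (suc k) *_) (sumℚ-map-*ˡ (inv (q ^ (suc j ℕ.* suc j))) (g (suc j)) (decSeqs q m j)) ⟩
      commaFactor (suc k) * (inv (q ^ (suc j ℕ.* suc j)) * W m (+ p ∷ ss) (+ t ∷ ts) (suc j)) ∎

  W-alternating : ∀ k → W 0 (+ 0 ∷ []) (+ 0 ∷ []) k ≡ alternating k
  W-alternating k = begin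
    sign q k * q ^ (k ℕ.* k ℕ.∸ triangle k) * (blockFactor k 0 0 * 1ℚ) + 0ℚ
      ≡⟨ cong₂ (λ x y → sign q k * x * (y * 1ℚ) + 0ℚ) (trans (cong (q ^_) (square∸triangle k)) (^-+ q (triangle k) k))
                                                       (cong (λ x → (1ℚ + q ^ k) * x * 1ℚ) (q^ℤ[t-1]k 0 k)) ⟩
    sign q k * (q ^ triangle k * q ^ k) * ((1ℚ + q ^ k) * (1ℚ * inv (q ^ k)) * 1ℚ * 1ℚ) + 0ℚ
      ≡⟨ regroup (sign q k) (q ^ triangle k) (q ^ k) (inv (q ^ k)) ⟩
    alternating k * (q ^ k * inv (q ^ k))
      ≡⟨ cong (alternating k *_) (*-invʳ (q ^ k) (^-≢0 k q≢0)) ⟩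
    alternating k * 1ℚ
      ≡⟨ ℚₚ.*-identityʳ _ ⟩
    alternating k ∎
    where
    open ≡-Reasoning
    regroup : ∀ σ T e ie → σ * (T * e) * ((1ℚ + e) * (1ℚ * ie) * 1ℚ * 1ℚ) + 0ℚ ≡ σ * T * (1ℚ + e) * (e * ie)
    regroup = solve-∀ ℚ-ring

  W⁺ : List⁺ Pair → ℕ → ℚ
  W⁺ (d ∷ ds) = W (length ds) (+ proj₁ d ∷ Vec.map (λ x → + proj₁ x) (Vec.fromList ds))
                              (+ proj₂ d ∷ Vec.map (λ x → + proj₂ x) (Vec.fromList ds))

  HbarPairs-by-first : ∀ n B → HbarPairs q n (toList B) ≡ ∑ n (λ k → C n k * W⁺ B k)
  HbarPairs-by-first n (d ∷ ds) = Hbar-by-first n (length ds) _ _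

  W⁺-plus : ∀ a B k → W⁺ (plus (a , 1) B) k ≡ weight a k * W⁺ B k
  W⁺-plus a (d ∷ ds) = W-plus (length ds) a (proj₁ d) (proj₂ d) _ _

  W⁺-comma : ∀ B k → W⁺ (comma (1 , 1) B) (suc k) ≡ commaFactor (suc k) * ∑ k (λ j → inv (q ^ (j ℕ.* j)) * W⁺ B j)
  W⁺-comma (d ∷ ds) = W-comma (length ds) (proj₁ d) (proj₂ d) _ _

  HbarSum : ℕ → List (List⁺ Pair) → ℚ
  HbarSum n Bs = sumℚ (map (λ B → HbarPairs q n (toList B)) Bs)

  Expansion : List ℕ → List (List⁺ Pair) → Set
  Expansion L Bs = ∀ n → 1 ≤ n → Hstar q n L ≡ - HbarSum n Bs

  Hstar-∷ : ∀ L Bs → Expansion L Bs → ∀ a n →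
    Hstar q n (a ∷ L) ≡ - sumℚ (map (λ B → ∑ n (λ j → weight a j * ∑ j (λ k → C j k * W⁺ B k))) Bs)
  Hstar-∷ L Bs expansion a n = begin
    Hstar q n (a ∷ L)
      ≡⟨ sumℚ-range1 n _ ⟩
    ∑ n (λ j → weight a j * Hstar q j L)
      ≡⟨ ∑-cong n (λ j _ → cong (weight a (suc j) *_) (trans (expansion (suc j) (s≤s z≤n)) (cong -_ (expand (suc j))))) ⟩
    ∑ n (λ j → weight a j * - sumℚ (map (λ B → ∑ j (λ k → C j k * W⁺ B k)) Bs))
      ≡⟨ ∑-*-neg-sumℚ n (weight a) (λ j B → ∑ j (λ k → C j k * W⁺ B k)) Bs ⟩
    - sumℚ (map (λ B → ∑ n (λ j → weight a j * ∑ j (λ k → C j k * W⁺ B k))) Bs) ∎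
    where
    open ≡-Reasoning
    expand : ∀ j → HbarSum j Bs ≡ sumℚ (map (λ B → ∑ j (λ k → C j k * W⁺ B k)) Bs)
    expand j = sumℚ-map-cong Bs (HbarPairs-by-first j)

  expansion-[] : Expansion [] (((0 , 0) ∷ []) ∷ [])
  expansion-[] (suc n) _ = sym (cong (λ x → - (x + 0ℚ)) (begin
    HbarPairs q (suc n) ((0 , 0) ∷ [])
      ≡⟨ HbarPairs-by-first (suc n) ((0 , 0) ∷ []) ⟩
    ∑ (suc n) (λ k → C (suc n) k * W 0 (+ 0 ∷ []) (+ 0 ∷ []) k)
      ≡⟨ ∑-cong (suc n) (λ k _ → cong (C (suc n) (suc k) *_) (W-alternating (suc k))) ⟩
    ∑ (suc n) (λ k → C (suc n) k * alternating k)
      ≡⟨ ∑-C-alternating n ⟩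
    - 1ℚ ∎))
    where open ≡-Reasoning

  expansion-2 : ∀ L Bs → Expansion L Bs → Expansion (2 ∷ L) (map (plus (2 , 1)) Bs)
  expansion-2 L Bs expansion n _ = begin
    Hstar q n (2 ∷ L)
      ≡⟨ Hstar-∷ L Bs expansion 2 n ⟩
    - sumℚ (map (λ B → ∑ n (λ j → weight 2 j * ∑ j (λ k → C j k * W⁺ B k))) Bs)
      ≡⟨ cong -_ (sumℚ-map-cong Bs per-block) ⟩
    - sumℚ (map (λ B → HbarPairs q n (toList (plus (2 , 1) B))) Bs)
      ≡⟨ cong -_ (sym (sumℚ-map-∘ (λ B → HbarPairs q n (toList B)) (plus (2 , 1)) Bs)) ⟩
    - HbarSum n (map (plus (2 , 1)) Bs) ∎
    where
    open ≡-Reasoning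
    per-block : ∀ B → ∑ n (λ j → weight 2 j * ∑ j (λ k → C j k * W⁺ B k)) ≡ HbarPairs q n (toList (plus (2 , 1) B))
    per-block B = begin
      ∑ n (λ j → weight 2 j * ∑ j (λ k → C j k * W⁺ B k))
        ≡⟨ ∑-weight₂ (W⁺ B) n ⟩
      ∑ n (λ k → C n k * (weight 2 k * W⁺ B k))
        ≡⟨ ∑-cong n (λ k _ → cong (C n (suc k) *_) (sym (W⁺-plus 2 B (suc k)))) ⟩
      ∑ n (λ k → C n k * W⁺ (plus (2 , 1) B) k)
        ≡⟨ sym (HbarPairs-by-first n (plus (2 , 1) B)) ⟩
      HbarPairs q n (toList (plus (2 , 1) B)) ∎

  expansion-1 : ∀ L Bs → Expansion L Bs → Expansion (1 ∷ L) (map (comma (1 , 1)) Bs ++ map (plus (1 , 1)) Bs)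
  expansion-1 L Bs expansion n _ = begin
    Hstar q n (1 ∷ L)
      ≡⟨ Hstar-∷ L Bs expansion 1 n ⟩
    - sumℚ (map (λ B → ∑ n (λ j → weight 1 j * ∑ j (λ k → C j k * W⁺ B k))) Bs)
      ≡⟨ cong -_ (sumℚ-map-cong Bs per-block) ⟩
    - sumℚ (map (λ B → H (comma (1 , 1) B) + H (plus (1 , 1) B)) Bs)
      ≡⟨ cong -_ (sumℚ-map-+ (λ B → H (comma (1 , 1) B)) (λ B → H (plus (1 , 1) B)) Bs) ⟩
    - (sumℚ (map (λ B → H (comma (1 , 1) B)) Bs) + sumℚ (map (λ B → H (plus (1 , 1) B)) Bs))
      ≡⟨ cong -_ (cong₂ _+_ (sym (sumℚ-map-∘ H (comma (1 , 1)) Bs)) (sym (sumℚ-map-∘ H (plus (1 , 1)) Bs))) ⟩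
    - (HbarSum n (map (comma (1 , 1)) Bs) + HbarSum n (map (plus (1 , 1)) Bs))
      ≡⟨ cong -_ (sym (trans (cong sumℚ (Listₚ.map-++ H (map (comma (1 , 1)) Bs) _)) (sumℚ-++ (map H (map (comma (1 , 1)) Bs)) _))) ⟩
    - HbarSum n (map (comma (1 , 1)) Bs ++ map (plus (1 , 1)) Bs) ∎
    where
    open ≡-Reasoning
    H : List⁺ Pair → ℚ
    H B = HbarPairs q n (toList B)
    distribute : ∀ c x y → c * (x + y) ≡ c * x + c * y
    distribute = solve-∀ ℚ-ring
    per-block : ∀ B → ∑ n (λ j → weight 1 j * ∑ j (λ k → C j k * W⁺ B k)) ≡ H (comma (1 , 1) B) + H (plus (1 , 1) B)
    per-block B = begin
      ∑ n (λ j → weight 1 j * ∑ j (λ k → C j k * W⁺ B k))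
        ≡⟨ ∑-weight₁ (W⁺ B) n ⟩
      ∑ n (λ k → C n k * (commaFactor k * ∑ (ℕ.pred k) (λ j → inv (q ^ (j ℕ.* j)) * W⁺ B j) + weight 1 k * W⁺ B k))
        ≡⟨ ∑-cong n (λ k _ → trans (cong₂ (λ x y → C n (suc k) * (x + y)) (sym (W⁺-comma B k)) (sym (W⁺-plus 1 B (suc k))))
                                   (distribute (C n (suc k)) _ _)) ⟩
      ∑ n (λ k → C n k * W⁺ (comma (1 , 1) B) k + C n k * W⁺ (plus (1 , 1) B) k)
        ≡⟨ ∑-+ n _ _ ⟩
      ∑ n (λ k → C n k * W⁺ (comma (1 , 1) B) k) + ∑ n (λ k → C n k * W⁺ (plus (1 , 1) B) k)
        ≡⟨ sym (cong₂ _+_ (HbarPairs-by-first n (comma (1 , 1) B)) (HbarPairs-by-first n (plus (1 , 1) B))) ⟩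
      H (comma (1 , 1) B) + H (plus (1 , 1) B) ∎

  expansion-cong : ∀ {L L′ Bs Bs′} → L ≡ L′ → Bs ≡ Bs′ → Expansion L Bs → Expansion L′ Bs′
  expansion-cong refl refl expansion = expansion

  expansion-2s : ∀ x L Bs → Expansion L Bs → Expansion (replicate x 2 ++ L) (map (plus (2 ℕ.* x , x)) Bs)
  expansion-2s zero    L Bs expansion =
    expansion-cong {L} refl (sym (trans (Listₚ.map-cong (λ _ → refl) Bs) (Listₚ.map-id Bs))) expansion
  expansion-2s (suc x) L Bs expansion =
    expansion-cong {2 ∷ replicate x 2 ++ L} refl (trans (sym (Listₚ.map-∘ Bs)) (Listₚ.map-cong plus-plus Bs)) (expansion-2 (replicate x 2 ++ L) (map (plus (2 ℕ.* x , x)) Bs) (expansion-2s x L Bs expansion))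
    where
    plus-plus : ∀ B → plus (2 , 1) (plus (2 ℕ.* x , x) B) ≡ plus (2 ℕ.* suc x , suc x) B
    plus-plus (d ∷ ds) = cong (_∷ ds) (trans (sym (⊕-assoc (2 , 1) (2 ℕ.* x , x) d)) (cong (λ y → (y , suc x) ⊕ d) (double-suc x)))
      where
      double-suc : ∀ x → 2 ℕ.+ 2 ℕ.* x ≡ 2 ℕ.* suc x
      double-suc = ℕ-ring.solve-∀

  expansion-hArgs : ∀ {m} (s : Vec ℕ m) s′ → Expansion (hArgs s s′) (blocks s s′)
  expansion-hArgs []       s′ =
    expansion-cong (Listₚ.++-identityʳ (replicate s′ 2))
                   (cong (λ d → (d ∷ []) ∷ []) (cong₂ _,_ (ℕₚ.+-identityʳ (2 ℕ.* s′)) (ℕₚ.+-identityʳ s′)))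
                   (expansion-2s s′ [] (((0 , 0) ∷ []) ∷ []) expansion-[])
  expansion-hArgs (x ∷ xs) s′ =
    expansion-cong {hArgs (x ∷ xs) s′} refl regroup (expansion-2s x (1 ∷ hArgs xs s′) (map (comma (1 , 1)) Bs ++ map (plus (1 , 1)) Bs)
                                  (expansion-1 (hArgs xs s′) Bs (expansion-hArgs xs s′)))
    where
    Bs = blocks xs s′
    plus-plus : ∀ B → plus (2 ℕ.* x , x) (plus (1 , 1) B) ≡ plus (oddPair x) B
    plus-plus (d ∷ ds) = cong (_∷ ds) (sym (⊕-assoc (2 ℕ.* x , x) (1 , 1) d))
    regroup : map (plus (2 ℕ.* x , x)) (map (comma (1 , 1)) Bs ++ map (plus (1 , 1)) Bs) ≡ blocks (x ∷ xs) s′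
    regroup = trans (Listₚ.map-++ (plus (2 ℕ.* x , x)) (map (comma (1 , 1)) Bs) _)
                    (cong₂ _++_ (trans (sym (Listₚ.map-∘ Bs)) (Listₚ.map-cong (λ _ → refl) Bs))
                                (trans (sym (Listₚ.map-∘ Bs)) (Listₚ.map-cong plus-plus Bs)))

-- the identity holds for sₘ₊₁ = 0 as well
theorem3p3 : (q : ℚ) → 0ℚ < q → q < 1ℚ →
             (m : ℕ) (s : Vec ℕ m) (sₘ₊₁ : ℕ) → 1 ≤ sₘ₊₁ →
             (n : ℕ) → 1 ≤ n →
             Hstar q n (hArgs s sₘ₊₁)
               ≡ - sumℚ (map (HbarPairs q n) (compositions s sₘ₊₁))
theorem3p3 q 0<q q<1 m s sₘ₊₁ _ n 1≤n = begin
  Hstar q n (hArgs s sₘ₊₁)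
    ≡⟨ expansion-hArgs q q≢0 1-q^suc≢0 s sₘ₊₁ n 1≤n ⟩
  - sumℚ (map (λ B → HbarPairs q n (toList B)) (blocks s sₘ₊₁))
    ≡⟨ cong -_ (sym (sumℚ-map-∘ (HbarPairs q n) toList (blocks s sₘ₊₁))) ⟩
  - sumℚ (map (HbarPairs q n) (map toList (blocks s sₘ₊₁)))
    ≡⟨ cong (λ cs → - sumℚ (map (HbarPairs q n) cs)) (blocks-compositions s sₘ₊₁) ⟩
  - sumℚ (map (HbarPairs q n) (compositions s sₘ₊₁)) ∎
  where
  open ≡-Reasoning
  q≢0 : q ≢ 0ℚ
  q≢0 q≡0 = ℚₚ.<-irrefl (sym q≡0) 0<q
  1-q^suc≢0 : ∀ k → 1ℚ - q ^ suc k ≢ 0ℚ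
  1-q^suc≢0 k = <1⇒1-≢0 (^-suc-<1 (ℚₚ.<⇒≤ 0<q) q<1 k)
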